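{- Let $F,G:\mathscr A\to\mathscr B$ be a coreflexive pair of 2-functors, i.e. there is a 2-functor $S:\mathscr B\to\mathscr A$ with $S\circ F=S\circ G=\mathrm{id}_{\mathscr A}$, and let $E:\mathscr E\to\mathscr A$ be an equalizer of $F$ and $G$ in $\mathbf{2}\text{ - }\mathbf{Cat}$. Then for every 2-category $\mathscr C$, the 2-functor $\mathscr C\boxtimes E:\mathscr C\boxtimes\mathscr E\to\mathscr C\boxtimes\mathscr A$ exhibits $\mathscr C\boxtimes\mathscr E$ as a (coreflexive) equalizer of $\mathscr C\boxtimes F,\mathscr C\boxtimes G:\mathscr C\boxtimes\mathscr A\to\mathscr C\boxtimes\mathscr B$.
   Context: $\mathbf{2}\text{ - }\mathbf{Cat}$ is the category of small 2-categories and 2-functors. The Gray tensor product $\mathscr A\boxtimes\mathscr B$ of 2-categories has objects the pairs $(A,B)$; its 1-cells are generated by $(a,B):(A,B)\to(A',B)$ for 1-cells $a:A\to A'$ of $\mathscr A$ and $(A,b):(A,B)\to(A,B')$ for 1-cells $b:B\to B'$ of $\mathscr B$, subject only to $(a,B)\cdot(a',B)=(a'\circ a,B)$, $(\mathrm{id}_A,B)=\mathrm{id}_{(A,B)}$, $(A,b)\cdot(A,b')=(A,b'\circ b)$, $(A,\mathrm{id}_B)=\mathrm{id}_{(A,B)}$ (so the underlying category is the funny tensor product of the underlying categories); a 2-cell $f\Rightarrow g$ between 1-cells $f,g:(A,B)\to(A',B')$ is a pair consisting of a 2-cell $\pi_1(f)\Rightarrow\pi_1(g)$ of $\mathscr A$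 and a 2-cell $\pi_2(f)\Rightarrow\pi_2(g)$ of $\mathscr B$, where $\pi_1,\pi_2$ are the projections of 1-cells (sending generators of the other variable to identities), compositions being componentwise. Equivalently, $\mathscr A\boxtimes\mathscr B$ is the unique 2-category through which the canonical 2-functor from the funny tensor product of underlying categories to $\mathscr A\times\mathscr B$ factors as an identity-on-objects-and-1-cells 2-functor followed by a locally fully faithful 2-functor. The Gray tensor product is functorial in 2-functors. -}

module Defs where

-- Strict 2-categories, presented (constructively, without quotients) as
-- 2-globular setoids with partial compositions; 2-functors; equalizers in
-- 2-Cat; the funny tensor product of categories and the Gray tensor product
-- of 2-categories (1-cells: funny tensor; 2-cells: pairs of 2-cells between
-- the projections); functoriality of the Gray tensor in 2-functors.

open import Level using (0ℓ)
open import Data.Unit using (⊤; tt)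
open import Data.Product using (Σ; _×_; _,_; proj₁; proj₂)
open import Data.Sum using (_⊎_; inj₁; inj₂)
open import Data.List using (List; []; _∷_; _++_; map)
open import Data.List.Properties using (++-assoc; ++-identityʳ; map-++)
open import Relation.Binary using (Rel; IsEquivalence)
open import Relation.Binary.PropositionalEquality as PE using (_≡_)

record Cat : Set₁ where
  infix 4 _≈₀_ _≈₁_
  field
    Ob       : Set
    _≈₀_     : Rel Ob 0ℓ
    isEq₀    : IsEquivalence _≈₀_
    Hom      : Set
    _≈₁_     : Rel Hom 0ℓ
    isEq₁    : IsEquivalence _≈₁_
    src tgt  : Hom → Ob
    src-cong : ∀ {f g} → f ≈₁ g → src f ≈₀ src g
    tgt-cong : ∀ {f g} → f ≈₁ g → tgt f ≈₀ tgt g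
    idn      : Ob → Hom
    idn-cong : ∀ {x y} → x ≈₀ y → idn x ≈₁ idn y
    src-idn  : ∀ x → src (idn x) ≈₀ x
    tgt-idn  : ∀ x → tgt (idn x) ≈₀ x
    -- diagrammatic order: cmp f g p  is  "f then g"
    cmp      : (f g : Hom) → tgt f ≈₀ src g → Hom
    cmp-cong : ∀ {f f' g g'} → f ≈₁ f' → g ≈₁ g' →
               (p : tgt f ≈₀ src g) (p' : tgt f' ≈₀ src g') →
               cmp f g p ≈₁ cmp f' g' p'
    src-cmp  : ∀ f g (p : tgt f ≈₀ src g) → src (cmp f g p) ≈₀ src f
    tgt-cmp  : ∀ f g (p : tgt f ≈₀ src g) → tgt (cmp f g p) ≈₀ tgt g
    idˡ      : ∀ f (p : tgt (idn (src f)) ≈₀ src f) → cmp (idn (src f)) f p ≈₁ f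
    idʳ      : ∀ f (p : tgt f ≈₀ src (idn (tgt f))) → cmp f (idn (tgt f)) p ≈₁ f
    assoc    : ∀ f g h (p : tgt f ≈₀ src g) (q : tgt g ≈₀ src h)
                 (r : tgt (cmp f g p) ≈₀ src h) (s : tgt f ≈₀ src (cmp g h q)) →
               cmp (cmp f g p) h r ≈₁ cmp f (cmp g h q) s

  refl₀ : ∀ {x} → x ≈₀ x
  refl₀ = IsEquivalence.refl isEq₀
  sym₀ : ∀ {x y} → x ≈₀ y → y ≈₀ x
  sym₀ = IsEquivalence.sym isEq₀
  trans₀ : ∀ {x y z} → x ≈₀ y → y ≈₀ z → x ≈₀ z
  trans₀ = IsEquivalence.trans isEq₀
  refl₁ : ∀ {x} → x ≈₁ x
  refl₁ = IsEquivalence.refl isEq₁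
  sym₁ : ∀ {x y} → x ≈₁ y → y ≈₁ x
  sym₁ = IsEquivalence.sym isEq₁
  trans₁ : ∀ {x y z} → x ≈₁ y → y ≈₁ z → x ≈₁ z
  trans₁ = IsEquivalence.trans isEq₁

record TwoCat : Set₁ where
  field
    cat : Cat
  open Cat cat public
  infix 4 _≈₂_
  field
    Cell      : Set
    _≈₂_      : Rel Cell 0ℓ
    isEq₂     : IsEquivalence _≈₂_
    dom cod   : Cell → Hom
    dom-cong  : ∀ {α β} → α ≈₂ β → dom α ≈₁ dom β
    cod-cong  : ∀ {α β} → α ≈₂ β → cod α ≈₁ cod β
    glob-src  : ∀ α → src (dom α) ≈₀ src (cod α)
    glob-tgt  : ∀ α → tgt (dom α) ≈₀ tgt (cod α)
    idc       : Hom → Cell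
    idc-cong  : ∀ {f g} → f ≈₁ g → idc f ≈₂ idc g
    dom-idc   : ∀ f → dom (idc f) ≈₁ f
    cod-idc   : ∀ f → cod (idc f) ≈₁ f
    -- vertical composition (diagrammatic order)
    vcmp      : (α β : Cell) → cod α ≈₁ dom β → Cell
    vcmp-cong : ∀ {α α' β β'} → α ≈₂ α' → β ≈₂ β' →
                (p : cod α ≈₁ dom β) (p' : cod α' ≈₁ dom β') →
                vcmp α β p ≈₂ vcmp α' β' p'
    dom-vcmp  : ∀ α β (p : cod α ≈₁ dom β) → dom (vcmp α β p) ≈₁ dom α
    cod-vcmp  : ∀ α β (p : cod α ≈₁ dom β) → cod (vcmp α β p) ≈₁ cod β
    vidˡ      : ∀ α (p : cod (idc (dom α)) ≈₁ dom α) → vcmp (idc (dom α)) α p ≈₂ α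
    vidʳ      : ∀ α (p : cod α ≈₁ dom (idc (cod α))) → vcmp α (idc (cod α)) p ≈₂ α
    vassoc    : ∀ α β γ (p : cod α ≈₁ dom β) (q : cod β ≈₁ dom γ)
                  (r : cod (vcmp α β p) ≈₁ dom γ) (s : cod α ≈₁ dom (vcmp β γ q)) →
                vcmp (vcmp α β p) γ r ≈₂ vcmp α (vcmp β γ q) s
    -- horizontal composition (diagrammatic order)
    hcmp      : (α β : Cell) → tgt (dom α) ≈₀ src (dom β) → Cell
    hcmp-cong : ∀ {α α' β β'} → α ≈₂ α' → β ≈₂ β' →
                (p : tgt (dom α) ≈₀ src (dom β)) (p' : tgt (dom α') ≈₀ src (dom β')) →
                hcmp α β p ≈₂ hcmp α' β' p'
    dom-hcmp  : ∀ α β (p : tgt (dom α) ≈₀ src (dom β)) (q : tgt (dom α) ≈₀ src (dom β)) →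
                dom (hcmp α β p) ≈₁ cmp (dom α) (dom β) q
    cod-hcmp  : ∀ α β (p : tgt (dom α) ≈₀ src (dom β)) (q : tgt (cod α) ≈₀ src (cod β)) →
                cod (hcmp α β p) ≈₁ cmp (cod α) (cod β) q
    hidˡ      : ∀ α (p : tgt (dom (idc (idn (src (dom α))))) ≈₀ src (dom α)) →
                hcmp (idc (idn (src (dom α)))) α p ≈₂ α
    hidʳ      : ∀ α (p : tgt (dom α) ≈₀ src (dom (idc (idn (tgt (dom α)))))) →
                hcmp α (idc (idn (tgt (dom α)))) p ≈₂ α
    hassoc    : ∀ α β γ (p : tgt (dom α) ≈₀ src (dom β)) (q : tgt (dom β) ≈₀ src (dom γ))
                  (r : tgt (dom (hcmp α β p)) ≈₀ src (dom γ))
                  (s : tgt (dom α) ≈₀ src (dom (hcmp β γ q))) →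
                hcmp (hcmp α β p) γ r ≈₂ hcmp α (hcmp β γ q) s
    hcmp-idc  : ∀ f g (p : tgt (dom (idc f)) ≈₀ src (dom (idc g))) (q : tgt f ≈₀ src g) →
                hcmp (idc f) (idc g) p ≈₂ idc (cmp f g q)
    interchange : ∀ α β γ δ (p : cod α ≈₁ dom β) (q : cod γ ≈₁ dom δ)
                    (r : tgt (dom (vcmp α β p)) ≈₀ src (dom (vcmp γ δ q)))
                    (s : tgt (dom α) ≈₀ src (dom γ)) (t : tgt (dom β) ≈₀ src (dom δ))
                    (u : cod (hcmp α γ s) ≈₁ dom (hcmp β δ t)) →
                  hcmp (vcmp α β p) (vcmp γ δ q) r ≈₂ vcmp (hcmp α γ s) (hcmp β δ t) u

  refl₂ : ∀ {x} → x ≈₂ x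
  refl₂ = IsEquivalence.refl isEq₂
  sym₂ : ∀ {x y} → x ≈₂ y → y ≈₂ x
  sym₂ = IsEquivalence.sym isEq₂
  trans₂ : ∀ {x y z} → x ≈₂ y → y ≈₂ z → x ≈₂ z
  trans₂ = IsEquivalence.trans isEq₂

record CatFun (C D : Cat) : Set where
  private
    module C = Cat C
    module D = Cat D
  field
    F₀      : C.Ob → D.Ob
    F₀-cong : ∀ {x y} → x C.≈₀ y → F₀ x D.≈₀ F₀ y
    F₁      : C.Hom → D.Hom
    F₁-cong : ∀ {f g} → f C.≈₁ g → F₁ f D.≈₁ F₁ g
    F-src   : ∀ f → D.src (F₁ f) D.≈₀ F₀ (C.src f)
    F-tgt   : ∀ f → D.tgt (F₁ f) D.≈₀ F₀ (C.tgt f)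
    F-idn   : ∀ x → F₁ (C.idn x) D.≈₁ D.idn (F₀ x)
    F-cmp   : ∀ f g (p : C.tgt f C.≈₀ C.src g) (q : D.tgt (F₁ f) D.≈₀ D.src (F₁ g)) →
              F₁ (C.cmp f g p) D.≈₁ D.cmp (F₁ f) (F₁ g) q

record Fun (A B : TwoCat) : Set where
  private
    module A = TwoCat A
    module B = TwoCat B
  field
    F : CatFun A.cat B.cat
  open CatFun F public
  field
    F₂      : A.Cell → B.Cell
    F₂-cong : ∀ {α β} → α A.≈₂ β → F₂ α B.≈₂ F₂ β
    F-dom   : ∀ α → B.dom (F₂ α) B.≈₁ F₁ (A.dom α)
    F-cod   : ∀ α → B.cod (F₂ α) B.≈₁ F₁ (A.cod α)
    F-idc   : ∀ f → F₂ (A.idc f) B.≈₂ B.idc (F₁ f)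
    F-vcmp  : ∀ α β (p : A.cod α A.≈₁ A.dom β) (q : B.cod (F₂ α) B.≈₁ B.dom (F₂ β)) →
              F₂ (A.vcmp α β p) B.≈₂ B.vcmp (F₂ α) (F₂ β) q
    F-hcmp  : ∀ α β (p : A.tgt (A.dom α) A.≈₀ A.src (A.dom β))
                (q : B.tgt (B.dom (F₂ α)) B.≈₀ B.src (B.dom (F₂ β))) →
              F₂ (A.hcmp α β p) B.≈₂ B.hcmp (F₂ α) (F₂ β) q

idF : ∀ {A} → Fun A A
idF {A} = record
  { F = record
      { F₀ = λ x → x ; F₀-cong = λ e → e ; F₁ = λ f → f ; F₁-cong = λ e → e
      ; F-src = λ _ → A.refl₀ ; F-tgt = λ _ → A.refl₀ ; F-idn = λ _ → A.refl₁
      ; F-cmp = λ f g p q → A.cmp-cong A.refl₁ A.refl₁ p q }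
  ; F₂ = λ α → α ; F₂-cong = λ e → e ; F-dom = λ _ → A.refl₁ ; F-cod = λ _ → A.refl₁
  ; F-idc = λ _ → A.refl₂
  ; F-vcmp = λ α β p q → A.vcmp-cong A.refl₂ A.refl₂ p q
  ; F-hcmp = λ α β p q → A.hcmp-cong A.refl₂ A.refl₂ p q }
  where module A = TwoCat A

infixr 9 _∘F_
_∘F_ : ∀ {A B D} → Fun B D → Fun A B → Fun A D
_∘F_ {A} {B} {D} F G = record
  { F = record
      { F₀ = λ x → F.F₀ (G.F₀ x)
      ; F₀-cong = λ e → F.F₀-cong (G.F₀-cong e)
      ; F₁ = λ f → F.F₁ (G.F₁ f)
      ; F₁-cong = λ e → F.F₁-cong (G.F₁-cong e)
      ; F-src = λ f → D.trans₀ (F.F-src _) (F.F₀-cong (G.F-src f))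
      ; F-tgt = λ f → D.trans₀ (F.F-tgt _) (F.F₀-cong (G.F-tgt f))
      ; F-idn = λ x → D.trans₁ (F.F₁-cong (G.F-idn x)) (F.F-idn _)
      ; F-cmp = λ f g p q → D.trans₁ (F.F₁-cong (G.F-cmp f g p (r f g p))) (F.F-cmp _ _ _ q) }
  ; F₂ = λ α → F.F₂ (G.F₂ α)
  ; F₂-cong = λ e → F.F₂-cong (G.F₂-cong e)
  ; F-dom = λ α → D.trans₁ (F.F-dom _) (F.F₁-cong (G.F-dom α))
  ; F-cod = λ α → D.trans₁ (F.F-cod _) (F.F₁-cong (G.F-cod α))
  ; F-idc = λ f → D.trans₂ (F.F₂-cong (G.F-idc f)) (F.F-idc _)
  ; F-vcmp = λ α β p q → D.trans₂ (F.F₂-cong (G.F-vcmp α β p (rv α β p))) (F.F-vcmp _ _ _ q)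
  ; F-hcmp = λ α β p q → D.trans₂ (F.F₂-cong (G.F-hcmp α β p (rh α β p))) (F.F-hcmp _ _ _ q) }
  where
    module A = TwoCat A
    module B = TwoCat B
    module D = TwoCat D
    module F = Fun F
    module G = Fun G
    r : ∀ f g → A.tgt f A.≈₀ A.src g → B.tgt (G.F₁ f) B.≈₀ B.src (G.F₁ g)
    r f g p = B.trans₀ (G.F-tgt f) (B.trans₀ (G.F₀-cong p) (B.sym₀ (G.F-src g)))
    rv : ∀ α β → A.cod α A.≈₁ A.dom β → B.cod (G.F₂ α) B.≈₁ B.dom (G.F₂ β)
    rv α β p = B.trans₁ (G.F-cod α) (B.trans₁ (G.F₁-cong p) (B.sym₁ (G.F-dom β)))
    rh : ∀ α β → A.tgt (A.dom α) A.≈₀ A.src (A.dom β) →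
         B.tgt (B.dom (G.F₂ α)) B.≈₀ B.src (B.dom (G.F₂ β))
    rh α β p = B.trans₀ (B.tgt-cong (G.F-dom α))
                 (B.trans₀ (r _ _ p) (B.sym₀ (B.src-cong (G.F-dom β))))

infix 4 _≐_
_≐_ : ∀ {A B} → Fun A B → Fun A B → Set
_≐_ {A} {B} F G =
  (∀ x → Fun.F₀ F x B.≈₀ Fun.F₀ G x) ×
  (∀ f → Fun.F₁ F f B.≈₁ Fun.F₁ G f) ×
  (∀ α → Fun.F₂ F α B.≈₂ Fun.F₂ G α)
  where
    module A = TwoCat A
    module B = TwoCat B

IsEqualizer : ∀ {A B Eq} → Fun A B → Fun A B → Fun Eq A → Set₁
IsEqualizer {A} {B} {Eq} F G E =
  (F ∘F E ≐ G ∘F E) ×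
  (∀ (X : TwoCat) (H : Fun X A) → F ∘F H ≐ G ∘F H →
     Σ (Fun X Eq) (λ K → E ∘F K ≐ H)) ×
  (∀ (X : TwoCat) (K K' : Fun X Eq) → E ∘F K ≐ E ∘F K' → K ≐ K')

_×C_ : Cat → Cat → Cat
C ×C A = record
  { Ob = C.Ob × A.Ob
  ; _≈₀_ = λ x y → (proj₁ x C.≈₀ proj₁ y) × (proj₂ x A.≈₀ proj₂ y)
  ; isEq₀ = record { refl = C.refl₀ , A.refl₀
                   ; sym = λ e → C.sym₀ (proj₁ e) , A.sym₀ (proj₂ e)
                   ; trans = λ e e' → C.trans₀ (proj₁ e) (proj₁ e') , A.trans₀ (proj₂ e) (proj₂ e') }
  ; Hom = C.Hom × A.Hom
  ; _≈₁_ = λ x y → (proj₁ x C.≈₁ proj₁ y) × (proj₂ x A.≈₁ proj₂ y)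
  ; isEq₁ = record { refl = C.refl₁ , A.refl₁
                   ; sym = λ e → C.sym₁ (proj₁ e) , A.sym₁ (proj₂ e)
                   ; trans = λ e e' → C.trans₁ (proj₁ e) (proj₁ e') , A.trans₁ (proj₂ e) (proj₂ e') }
  ; src = λ f → C.src (proj₁ f) , A.src (proj₂ f)
  ; tgt = λ f → C.tgt (proj₁ f) , A.tgt (proj₂ f)
  ; src-cong = λ e → C.src-cong (proj₁ e) , A.src-cong (proj₂ e)
  ; tgt-cong = λ e → C.tgt-cong (proj₁ e) , A.tgt-cong (proj₂ e)
  ; idn = λ x → C.idn (proj₁ x) , A.idn (proj₂ x)
  ; idn-cong = λ e → C.idn-cong (proj₁ e) , A.idn-cong (proj₂ e)
  ; src-idn = λ x → C.src-idn _ , A.src-idn _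
  ; tgt-idn = λ x → C.tgt-idn _ , A.tgt-idn _
  ; cmp = λ f g p → C.cmp (proj₁ f) (proj₁ g) (proj₁ p) , A.cmp (proj₂ f) (proj₂ g) (proj₂ p)
  ; cmp-cong = λ e e' p p' → C.cmp-cong (proj₁ e) (proj₁ e') _ _ , A.cmp-cong (proj₂ e) (proj₂ e') _ _
  ; src-cmp = λ f g p → C.src-cmp _ _ _ , A.src-cmp _ _ _
  ; tgt-cmp = λ f g p → C.tgt-cmp _ _ _ , A.tgt-cmp _ _ _
  ; idˡ = λ f p → C.idˡ _ _ , A.idˡ _ _
  ; idʳ = λ f p → C.idʳ _ _ , A.idʳ _ _
  ; assoc = λ f g h p q r s → C.assoc _ _ _ _ _ _ _ , A.assoc _ _ _ _ _ _ _ }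
  where
    module C = Cat C
    module A = Cat A

_×₂_ : TwoCat → TwoCat → TwoCat
C ×₂ A = record
  { cat = C.cat ×C A.cat
  ; Cell = C.Cell × A.Cell
  ; _≈₂_ = λ x y → (proj₁ x C.≈₂ proj₁ y) × (proj₂ x A.≈₂ proj₂ y)
  ; isEq₂ = record { refl = C.refl₂ , A.refl₂
                   ; sym = λ e → C.sym₂ (proj₁ e) , A.sym₂ (proj₂ e)
                   ; trans = λ e e' → C.trans₂ (proj₁ e) (proj₁ e') , A.trans₂ (proj₂ e) (proj₂ e') }
  ; dom = λ α → C.dom (proj₁ α) , A.dom (proj₂ α)
  ; cod = λ α → C.cod (proj₁ α) , A.cod (proj₂ α)
  ; dom-cong = λ e → C.dom-cong (proj₁ e) , A.dom-cong (proj₂ e)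
  ; cod-cong = λ e → C.cod-cong (proj₁ e) , A.cod-cong (proj₂ e)
  ; glob-src = λ α → C.glob-src _ , A.glob-src _
  ; glob-tgt = λ α → C.glob-tgt _ , A.glob-tgt _
  ; idc = λ f → C.idc (proj₁ f) , A.idc (proj₂ f)
  ; idc-cong = λ e → C.idc-cong (proj₁ e) , A.idc-cong (proj₂ e)
  ; dom-idc = λ f → C.dom-idc _ , A.dom-idc _
  ; cod-idc = λ f → C.cod-idc _ , A.cod-idc _
  ; vcmp = λ α β p → C.vcmp (proj₁ α) (proj₁ β) (proj₁ p) , A.vcmp (proj₂ α) (proj₂ β) (proj₂ p)
  ; vcmp-cong = λ e e' p p' → C.vcmp-cong (proj₁ e) (proj₁ e') _ _ , A.vcmp-cong (proj₂ e) (proj₂ e') _ _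
  ; dom-vcmp = λ α β p → C.dom-vcmp _ _ _ , A.dom-vcmp _ _ _
  ; cod-vcmp = λ α β p → C.cod-vcmp _ _ _ , A.cod-vcmp _ _ _
  ; vidˡ = λ α p → C.vidˡ _ _ , A.vidˡ _ _
  ; vidʳ = λ α p → C.vidʳ _ _ , A.vidʳ _ _
  ; vassoc = λ α β γ p q r s → C.vassoc _ _ _ _ _ _ _ , A.vassoc _ _ _ _ _ _ _
  ; hcmp = λ α β p → C.hcmp (proj₁ α) (proj₁ β) (proj₁ p) , A.hcmp (proj₂ α) (proj₂ β) (proj₂ p)
  ; hcmp-cong = λ e e' p p' → C.hcmp-cong (proj₁ e) (proj₁ e') _ _ , A.hcmp-cong (proj₂ e) (proj₂ e') _ _
  ; dom-hcmp = λ α β p q → C.dom-hcmp _ _ _ _ , A.dom-hcmp _ _ _ _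
  ; cod-hcmp = λ α β p q → C.cod-hcmp _ _ _ _ , A.cod-hcmp _ _ _ _
  ; hidˡ = λ α p → C.hidˡ _ _ , A.hidˡ _ _
  ; hidʳ = λ α p → C.hidʳ _ _ , A.hidʳ _ _
  ; hassoc = λ α β γ p q r s → C.hassoc _ _ _ _ _ _ _ , A.hassoc _ _ _ _ _ _ _
  ; hcmp-idc = λ f g p q → C.hcmp-idc _ _ _ _ , A.hcmp-idc _ _ _ _
  ; interchange = λ α β γ δ p q r s t u →
      C.interchange _ _ _ _ _ _ _ _ _ _ , A.interchange _ _ _ _ _ _ _ _ _ _ }
  where
    module C = TwoCat C
    module A = TwoCat A

prodMap : ∀ (C : TwoCat) {A B} → Fun A B → Fun (C ×₂ A) (C ×₂ B)
prodMap C {A} {B} F = record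
  { F = record
      { F₀ = λ x → proj₁ x , F.F₀ (proj₂ x)
      ; F₀-cong = λ e → proj₁ e , F.F₀-cong (proj₂ e)
      ; F₁ = λ f → proj₁ f , F.F₁ (proj₂ f)
      ; F₁-cong = λ e → proj₁ e , F.F₁-cong (proj₂ e)
      ; F-src = λ f → C.refl₀ , F.F-src _
      ; F-tgt = λ f → C.refl₀ , F.F-tgt _
      ; F-idn = λ x → C.refl₁ , F.F-idn _
      ; F-cmp = λ f g p q → C.cmp-cong C.refl₁ C.refl₁ _ _ , F.F-cmp _ _ _ _ }
  ; F₂ = λ α → proj₁ α , F.F₂ (proj₂ α)
  ; F₂-cong = λ e → proj₁ e , F.F₂-cong (proj₂ e)
  ; F-dom = λ α → C.refl₁ , F.F-dom _
  ; F-cod = λ α → C.refl₁ , F.F-cod _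
  ; F-idc = λ f → C.refl₂ , F.F-idc _
  ; F-vcmp = λ α β p q → C.vcmp-cong C.refl₂ C.refl₂ _ _ , F.F-vcmp _ _ _ _
  ; F-hcmp = λ α β p q → C.hcmp-cong C.refl₂ C.refl₂ _ _ , F.F-hcmp _ _ _ _ }
  where
    module C = TwoCat C
    module F = Fun F

-- A morphism is a well-formed word of generators (c , B) [inj₁ c] and
-- (A , a) [inj₂ a], starting at an object; words are identified by the
-- equivalence relation generated by (c,B)·(c',B) = (c';c, B),
-- (id,B) = id, (A,a)·(A,a') = (A,a;a'), (A,id) = id (in context).

module Funny (C A : Cat) where
  private
    module C = Cat C
    module A = Cat A

  Ob : Set
  Ob = C.Ob × A.Ob

  infix 4 _≈O_ _≈G_ _≈L_
  _≈O_ : Ob → Ob → Set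
  x ≈O y = (proj₁ x C.≈₀ proj₁ y) × (proj₂ x A.≈₀ proj₂ y)

  reflO : ∀ {x} → x ≈O x
  reflO = C.refl₀ , A.refl₀
  symO : ∀ {x y} → x ≈O y → y ≈O x
  symO e = C.sym₀ (proj₁ e) , A.sym₀ (proj₂ e)
  transO : ∀ {x y z} → x ≈O y → y ≈O z → x ≈O z
  transO e e' = C.trans₀ (proj₁ e) (proj₁ e') , A.trans₀ (proj₂ e) (proj₂ e')

  Gen : Set
  Gen = C.Hom ⊎ A.Hom

  data _≈G_ : Gen → Gen → Set where
    g₁ : ∀ {c c'} → c C.≈₁ c' → inj₁ c ≈G inj₁ c'
    g₂ : ∀ {d d'} → d A.≈₁ d' → inj₂ d ≈G inj₂ d'

  data _≈L_ : List Gen → List Gen → Set where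
    []  : [] ≈L []
    _∷_ : ∀ {g g' u u'} → g ≈G g' → u ≈L u' → (g ∷ u) ≈L (g' ∷ u')

  reflG : ∀ g → g ≈G g
  reflG (inj₁ c) = g₁ C.refl₁
  reflG (inj₂ d) = g₂ A.refl₁
  symG : ∀ {g g'} → g ≈G g' → g' ≈G g
  symG (g₁ e) = g₁ (C.sym₁ e)
  symG (g₂ e) = g₂ (A.sym₁ e)
  reflL : ∀ u → u ≈L u
  reflL [] = []
  reflL (g ∷ u) = reflG g ∷ reflL u
  symL : ∀ {u u'} → u ≈L u' → u' ≈L u
  symL [] = []
  symL (e ∷ l) = symG e ∷ symL l
  ≡⇒≈L : ∀ {u v} → u ≡ v → u ≈L v
  ≡⇒≈L {u} PE.refl = reflL u

  step : Ob → Gen → Ob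
  step x (inj₁ c) = C.tgt c , proj₂ x
  step x (inj₂ d) = proj₁ x , A.tgt d

  tgtW : Ob → List Gen → Ob
  tgtW x [] = x
  tgtW x (g ∷ u) = tgtW (step x g) u

  GenOK : Ob → Gen → Set
  GenOK x (inj₁ c) = C.src c C.≈₀ proj₁ x
  GenOK x (inj₂ d) = A.src d A.≈₀ proj₂ x

  WF : Ob → List Gen → Set
  WF x [] = ⊤
  WF x (g ∷ u) = GenOK x g × WF (step x g) u

  step-cong : ∀ {x x' g g'} → x ≈O x' → g ≈G g' → step x g ≈O step x' g'
  step-cong e (g₁ e') = C.tgt-cong e' , proj₂ e
  step-cong e (g₂ e') = proj₁ e , A.tgt-cong e'

  GenOK-cong : ∀ {x x' g g'} → x ≈O x' → g ≈G g' → GenOK x g → GenOK x' g'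
  GenOK-cong e (g₁ e') ok = C.trans₀ (C.sym₀ (C.src-cong e')) (C.trans₀ ok (proj₁ e))
  GenOK-cong e (g₂ e') ok = A.trans₀ (A.sym₀ (A.src-cong e')) (A.trans₀ ok (proj₂ e))

  tgtW-cong : ∀ {x x' u u'} → x ≈O x' → u ≈L u' → tgtW x u ≈O tgtW x' u'
  tgtW-cong e [] = e
  tgtW-cong e (eg ∷ l) = tgtW-cong (step-cong e eg) l

  tgtW-++ : ∀ x u v → tgtW x (u ++ v) ≡ tgtW (tgtW x u) v
  tgtW-++ x [] v = PE.refl
  tgtW-++ x (g ∷ u) v = tgtW-++ (step x g) u v

  WF-cong : ∀ {x x' u u'} → x ≈O x' → u ≈L u' → WF x u → WF x' u'
  WF-cong e [] ok = tt
  WF-cong e (eg ∷ l) (ok , oks) = GenOK-cong e eg ok , WF-cong (step-cong e eg) l oks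

  WF-++ : ∀ x u v → WF x u → WF (tgtW x u) v → WF x (u ++ v)
  WF-++ x [] v _ ok = ok
  WF-++ x (g ∷ u) v (ok , oks) ok' = ok , WF-++ (step x g) u v oks ok'

  WF-++₁ : ∀ x u v → WF x (u ++ v) → WF x u
  WF-++₁ x [] v _ = tt
  WF-++₁ x (g ∷ u) v (ok , oks) = ok , WF-++₁ (step x g) u v oks

  WF-++₂ : ∀ x u v → WF x (u ++ v) → WF (tgtW x u) v
  WF-++₂ x [] v ok = ok
  WF-++₂ x (g ∷ u) v (ok , oks) = WF-++₂ (step x g) u v oks

  data R : Ob → List Gen → Ob → List Gen → Set where
    ~refl  : ∀ {x u} → R x u x u
    ~sym   : ∀ {x u y v} → R x u y v → R y v x u
    ~trans : ∀ {x u y v z w} → R x u y v → R y v z w → R x u z w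
    ~cong  : ∀ {x u y v} → x ≈O y → u ≈L v → R x u y v
    ~app   : ∀ {x u x' u' v v'} → R x u x' u' → R (tgtW x u) v (tgtW x' u') v' →
             R x (u ++ v) x' (u' ++ v')
    ~cmp₁  : ∀ x c c' (p : C.tgt c C.≈₀ C.src c') →
             R x (inj₁ c ∷ inj₁ c' ∷ []) x (inj₁ (C.cmp c c' p) ∷ [])
    ~idn₁  : ∀ x z → z C.≈₀ proj₁ x → R x (inj₁ (C.idn z) ∷ []) x []
    ~cmp₂  : ∀ x d d' (p : A.tgt d A.≈₀ A.src d') →
             R x (inj₂ d ∷ inj₂ d' ∷ []) x (inj₂ (A.cmp d d' p) ∷ [])
    ~idn₂  : ∀ x z → z A.≈₀ proj₂ x → R x (inj₂ (A.idn z) ∷ []) x []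

  R-src : ∀ {x u y v} → R x u y v → x ≈O y
  R-src ~refl = reflO
  R-src (~sym r) = symO (R-src r)
  R-src (~trans r s) = transO (R-src r) (R-src s)
  R-src (~cong e _) = e
  R-src (~app r _) = R-src r
  R-src (~cmp₁ _ _ _ _) = reflO
  R-src (~idn₁ _ _ _) = reflO
  R-src (~cmp₂ _ _ _ _) = reflO
  R-src (~idn₂ _ _ _) = reflO

  R-tgt : ∀ {x u y v} → R x u y v → tgtW x u ≈O tgtW y v
  R-tgt ~refl = reflO
  R-tgt (~sym r) = symO (R-tgt r)
  R-tgt (~trans r s) = transO (R-tgt r) (R-tgt s)
  R-tgt (~cong e l) = tgtW-cong e l
  R-tgt (~app {x} {u} {x'} {u'} {v} {v'} r s)
    rewrite tgtW-++ x u v | tgtW-++ x' u' v' = R-tgt s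
  R-tgt (~cmp₁ x c c' p) = C.sym₀ (C.tgt-cmp c c' p) , A.refl₀
  R-tgt (~idn₁ x z e) = C.trans₀ (C.tgt-idn z) e , A.refl₀
  R-tgt (~cmp₂ x d d' p) = C.refl₀ , A.sym₀ (A.tgt-cmp d d' p)
  R-tgt (~idn₂ x z e) = C.refl₀ , A.trans₀ (A.tgt-idn z) e

  R-WF : ∀ {x u y v} → R x u y v → (WF x u → WF y v) × (WF y v → WF x u)
  R-WF ~refl = (λ w → w) , (λ w → w)
  R-WF (~sym r) = proj₂ (R-WF r) , proj₁ (R-WF r)
  R-WF (~trans r s) = (λ w → proj₁ (R-WF s) (proj₁ (R-WF r) w))
                    , (λ w → proj₂ (R-WF r) (proj₂ (R-WF s) w))
  R-WF (~cong e l) = WF-cong e l , WF-cong (symO e) (symL l)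
  R-WF (~app {x} {u} {x'} {u'} {v} {v'} r s) =
      (λ w → WF-++ x' u' v' (proj₁ (R-WF r) (WF-++₁ x u v w)) (proj₁ (R-WF s) (WF-++₂ x u v w)))
    , (λ w → WF-++ x u v (proj₂ (R-WF r) (WF-++₁ x' u' v' w)) (proj₂ (R-WF s) (WF-++₂ x' u' v' w)))
  R-WF (~cmp₁ x c c' p) =
      (λ { (a , (_ , _)) → C.trans₀ (C.src-cmp c c' p) a , tt })
    , (λ { (a , _) → C.trans₀ (C.sym₀ (C.src-cmp c c' p)) a , (C.sym₀ p , tt) })
  R-WF (~idn₁ x z e) = (λ _ → tt) , (λ _ → C.trans₀ (C.src-idn z) e , tt)
  R-WF (~cmp₂ x d d' p) =
      (λ { (a , (_ , _)) → A.trans₀ (A.src-cmp d d' p) a , tt })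
    , (λ { (a , _) → A.trans₀ (A.sym₀ (A.src-cmp d d' p)) a , (A.sym₀ p , tt) })
  R-WF (~idn₂ x z e) = (λ _ → tt) , (λ _ → A.trans₀ (A.src-idn z) e , tt)

  record W : Set where
    constructor w
    field
      st : Ob
      gs : List Gen
      wf : WF st gs
  open W public

  FunnyCat : Cat
  FunnyCat = record
    { Ob = Ob
    ; _≈₀_ = _≈O_
    ; isEq₀ = record { refl = reflO ; sym = symO ; trans = transO }
    ; Hom = W
    ; _≈₁_ = λ f g → R (st f) (gs f) (st g) (gs g)
    ; isEq₁ = record { refl = ~refl ; sym = ~sym ; trans = ~trans }
    ; src = st
    ; tgt = λ f → tgtW (st f) (gs f)
    ; src-cong = R-src
    ; tgt-cong = R-tgt
    ; idn = λ x → w x [] tt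
    ; idn-cong = λ e → ~cong e []
    ; src-idn = λ _ → reflO
    ; tgt-idn = λ _ → reflO
    ; cmp = λ f g p → w (st f) (gs f ++ gs g)
              (WF-++ (st f) (gs f) (gs g) (wf f) (WF-cong (symO p) (reflL (gs g)) (wf g)))
    ; cmp-cong = λ {f} {f'} {g} {g'} e₁ e₂ p p' →
        ~app e₁ (~trans (~cong p (reflL (gs g))) (~trans e₂ (~cong (symO p') (reflL (gs g')))))
    ; src-cmp = λ _ _ _ → reflO
    ; tgt-cmp = λ f g p → PE.subst (_≈O tgtW (st g) (gs g)) (PE.sym (tgtW-++ (st f) (gs f) (gs g)))
                              (tgtW-cong p (reflL (gs g)))
    ; idˡ = λ f p → ~refl
    ; idʳ = λ f p → ~cong reflO (≡⇒≈L (++-identityʳ (gs f)))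
    ; assoc = λ f g h p q r s → ~cong reflO (≡⇒≈L (++-assoc (gs f) (gs g) (gs h))) }

  π₁ : ∀ x u → WF x u → C.Hom
  π₁-src : ∀ x u (ok : WF x u) → C.src (π₁ x u ok) C.≈₀ proj₁ x
  π₁ x [] _ = C.idn (proj₁ x)
  π₁ x (inj₁ c ∷ u) (_ , ok) =
    C.cmp c (π₁ (step x (inj₁ c)) u ok) (C.sym₀ (π₁-src (step x (inj₁ c)) u ok))
  π₁ x (inj₂ d ∷ u) (_ , ok) = π₁ (step x (inj₂ d)) u ok
  π₁-src x [] _ = C.src-idn (proj₁ x)
  π₁-src x (inj₁ c ∷ u) (e , ok) = C.trans₀ (C.src-cmp _ _ _) e
  π₁-src x (inj₂ d ∷ u) (_ , ok) = π₁-src _ u ok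

  π₂ : ∀ x u → WF x u → A.Hom
  π₂-src : ∀ x u (ok : WF x u) → A.src (π₂ x u ok) A.≈₀ proj₂ x
  π₂ x [] _ = A.idn (proj₂ x)
  π₂ x (inj₂ d ∷ u) (_ , ok) =
    A.cmp d (π₂ (step x (inj₂ d)) u ok) (A.sym₀ (π₂-src (step x (inj₂ d)) u ok))
  π₂ x (inj₁ c ∷ u) (_ , ok) = π₂ (step x (inj₁ c)) u ok
  π₂-src x [] _ = A.src-idn (proj₂ x)
  π₂-src x (inj₂ d ∷ u) (e , ok) = A.trans₀ (A.src-cmp _ _ _) e
  π₂-src x (inj₁ c ∷ u) (_ , ok) = π₂-src _ u ok

  π₁-cong : ∀ {x x' u u'} → x ≈O x' → u ≈L u' → ∀ ok ok' → π₁ x u ok C.≈₁ π₁ x' u' ok'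
  π₁-cong e [] _ _ = C.idn-cong (proj₁ e)
  π₁-cong e (g₁ e' ∷ l) (_ , ok) (_ , ok') = C.cmp-cong e' (π₁-cong (step-cong e (g₁ e')) l ok ok') _ _
  π₁-cong e (g₂ e' ∷ l) (_ , ok) (_ , ok') = π₁-cong (step-cong e (g₂ e')) l ok ok'

  π₂-cong : ∀ {x x' u u'} → x ≈O x' → u ≈L u' → ∀ ok ok' → π₂ x u ok A.≈₁ π₂ x' u' ok'
  π₂-cong e [] _ _ = A.idn-cong (proj₂ e)
  π₂-cong e (g₂ e' ∷ l) (_ , ok) (_ , ok') = A.cmp-cong e' (π₂-cong (step-cong e (g₂ e')) l ok ok') _ _
  π₂-cong e (g₁ e' ∷ l) (_ , ok) (_ , ok') = π₂-cong (step-cong e (g₁ e')) l ok ok'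

  π₁-tgt : ∀ x u (ok : WF x u) → C.tgt (π₁ x u ok) C.≈₀ proj₁ (tgtW x u)
  π₁-tgt x [] _ = C.tgt-idn _
  π₁-tgt x (inj₁ c ∷ u) (_ , ok) = C.trans₀ (C.tgt-cmp _ _ _) (π₁-tgt _ u ok)
  π₁-tgt x (inj₂ d ∷ u) (_ , ok) = π₁-tgt _ u ok

  π₂-tgt : ∀ x u (ok : WF x u) → A.tgt (π₂ x u ok) A.≈₀ proj₂ (tgtW x u)
  π₂-tgt x [] _ = A.tgt-idn _
  π₂-tgt x (inj₂ d ∷ u) (_ , ok) = A.trans₀ (A.tgt-cmp _ _ _) (π₂-tgt _ u ok)
  π₂-tgt x (inj₁ c ∷ u) (_ , ok) = π₂-tgt _ u ok

  q₁ : ∀ x u v (ok₁ : WF x u) (ok₂ : WF (tgtW x u) v) →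
       C.tgt (π₁ x u ok₁) C.≈₀ C.src (π₁ (tgtW x u) v ok₂)
  q₁ x u v ok₁ ok₂ = C.trans₀ (π₁-tgt x u ok₁) (C.sym₀ (π₁-src (tgtW x u) v ok₂))

  q₂ : ∀ x u v (ok₁ : WF x u) (ok₂ : WF (tgtW x u) v) →
       A.tgt (π₂ x u ok₁) A.≈₀ A.src (π₂ (tgtW x u) v ok₂)
  q₂ x u v ok₁ ok₂ = A.trans₀ (π₂-tgt x u ok₁) (A.sym₀ (π₂-src (tgtW x u) v ok₂))

  π₁-++ : ∀ x u v (ok : WF x (u ++ v)) (ok₁ : WF x u) (ok₂ : WF (tgtW x u) v) q →
          π₁ x (u ++ v) ok C.≈₁ C.cmp (π₁ x u ok₁) (π₁ (tgtW x u) v ok₂) q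
  π₁-++ x [] v ok ok₁ ok₂ q =
    C.trans₁ (π₁-cong reflO (reflL v) ok ok₂)
      (C.trans₁ (C.sym₁ (C.idˡ (π₁ x v ok₂) (C.tgt-idn _)))
        (C.cmp-cong (C.idn-cong (π₁-src x v ok₂)) C.refl₁ _ _))
  π₁-++ x (inj₁ c ∷ u) v (e , ok) (e₁ , ok₁) ok₂ q =
    C.trans₁ (C.cmp-cong C.refl₁ (π₁-++ (step x (inj₁ c)) u v ok ok₁ ok₂ (q₁ _ u v ok₁ ok₂))
                 (C.sym₀ (π₁-src (step x (inj₁ c)) (u ++ v) ok))
                 (C.sym₀ (C.trans₀ (C.src-cmp _ _ _) (π₁-src (step x (inj₁ c)) u ok₁))))
      (C.sym₁ (C.assoc _ _ _ _ _ q _))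
  π₁-++ x (inj₂ d ∷ u) v (e , ok) (e₁ , ok₁) ok₂ q = π₁-++ (step x (inj₂ d)) u v ok ok₁ ok₂ q

  π₂-++ : ∀ x u v (ok : WF x (u ++ v)) (ok₁ : WF x u) (ok₂ : WF (tgtW x u) v) q →
          π₂ x (u ++ v) ok A.≈₁ A.cmp (π₂ x u ok₁) (π₂ (tgtW x u) v ok₂) q
  π₂-++ x [] v ok ok₁ ok₂ q =
    A.trans₁ (π₂-cong reflO (reflL v) ok ok₂)
      (A.trans₁ (A.sym₁ (A.idˡ (π₂ x v ok₂) (A.tgt-idn _)))
        (A.cmp-cong (A.idn-cong (π₂-src x v ok₂)) A.refl₁ _ _))
  π₂-++ x (inj₂ d ∷ u) v (e , ok) (e₁ , ok₁) ok₂ q =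
    A.trans₁ (A.cmp-cong A.refl₁ (π₂-++ (step x (inj₂ d)) u v ok ok₁ ok₂ (q₂ _ u v ok₁ ok₂))
                 (A.sym₀ (π₂-src (step x (inj₂ d)) (u ++ v) ok))
                 (A.sym₀ (A.trans₀ (A.src-cmp _ _ _) (π₂-src (step x (inj₂ d)) u ok₁))))
      (A.sym₁ (A.assoc _ _ _ _ _ q _))
  π₂-++ x (inj₁ c ∷ u) v (e , ok) (e₁ , ok₁) ok₂ q = π₂-++ (step x (inj₁ c)) u v ok ok₁ ok₂ q

  π₁-R : ∀ {x u y v} → R x u y v → ∀ ok ok' → π₁ x u ok C.≈₁ π₁ y v ok'
  π₁-R {u = u} ~refl ok ok' = π₁-cong reflO (reflL u) ok ok'
  π₁-R (~sym r) ok ok' = C.sym₁ (π₁-R r ok' ok)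
  π₁-R (~trans r s) ok ok' = C.trans₁ (π₁-R r ok (proj₁ (R-WF r) ok)) (π₁-R s _ ok')
  π₁-R (~cong e l) ok ok' = π₁-cong e l ok ok'
  π₁-R (~app {x} {u} {x'} {u'} {v} {v'} r s) ok ok' =
    C.trans₁ (π₁-++ x u v ok ok₁ ok₂ (q₁ x u v ok₁ ok₂))
      (C.trans₁ (C.cmp-cong (π₁-R r ok₁ ok₁') (π₁-R s ok₂ ok₂') _ (q₁ x' u' v' ok₁' ok₂'))
        (C.sym₁ (π₁-++ x' u' v' ok' ok₁' ok₂' _)))
    where
      ok₁ = WF-++₁ x u v ok
      ok₂ = WF-++₂ x u v ok
      ok₁' = WF-++₁ x' u' v' ok'
      ok₂' = WF-++₂ x' u' v' ok'
  π₁-R (~cmp₁ x c c' p) (_ , (_ , _)) _ =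
    C.trans₁ (C.cmp-cong C.refl₁ (C.idʳ c' _) _ p) (C.sym₁ (C.idʳ _ _))
  π₁-R (~idn₁ x z e) _ _ = C.trans₁ (C.idʳ _ _) (C.idn-cong e)
  π₁-R (~cmp₂ x d d' p) _ _ = C.refl₁
  π₁-R (~idn₂ x z e) _ _ = C.refl₁

  π₂-R : ∀ {x u y v} → R x u y v → ∀ ok ok' → π₂ x u ok A.≈₁ π₂ y v ok'
  π₂-R {u = u} ~refl ok ok' = π₂-cong reflO (reflL u) ok ok'
  π₂-R (~sym r) ok ok' = A.sym₁ (π₂-R r ok' ok)
  π₂-R (~trans r s) ok ok' = A.trans₁ (π₂-R r ok (proj₁ (R-WF r) ok)) (π₂-R s _ ok')
  π₂-R (~cong e l) ok ok' = π₂-cong e l ok ok'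
  π₂-R (~app {x} {u} {x'} {u'} {v} {v'} r s) ok ok' =
    A.trans₁ (π₂-++ x u v ok ok₁ ok₂ (q₂ x u v ok₁ ok₂))
      (A.trans₁ (A.cmp-cong (π₂-R r ok₁ ok₁') (π₂-R s ok₂ ok₂') _ (q₂ x' u' v' ok₁' ok₂'))
        (A.sym₁ (π₂-++ x' u' v' ok' ok₁' ok₂' _)))
    where
      ok₁ = WF-++₁ x u v ok
      ok₂ = WF-++₂ x u v ok
      ok₁' = WF-++₁ x' u' v' ok'
      ok₂' = WF-++₂ x' u' v' ok'
  π₂-R (~cmp₂ x d d' p) (_ , (_ , _)) _ =
    A.trans₁ (A.cmp-cong A.refl₁ (A.idʳ d' _) _ p) (A.sym₁ (A.idʳ _ _))
  π₂-R (~idn₂ x z e) _ _ = A.trans₁ (A.idʳ _ _) (A.idn-cong e)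
  π₂-R (~cmp₁ x c c' p) _ _ = A.refl₁
  π₂-R (~idn₁ x z e) _ _ = A.refl₁

  Π : CatFun FunnyCat (C ×C A)
  Π = record
    { F₀ = λ x → x
    ; F₀-cong = λ e → e
    ; F₁ = λ f → π₁ (st f) (gs f) (wf f) , π₂ (st f) (gs f) (wf f)
    ; F₁-cong = λ r → π₁-R r _ _ , π₂-R r _ _
    ; F-src = λ f → π₁-src (st f) (gs f) (wf f) , π₂-src (st f) (gs f) (wf f)
    ; F-tgt = λ f → π₁-tgt (st f) (gs f) (wf f) , π₂-tgt (st f) (gs f) (wf f)
    ; F-idn = λ x → C.refl₁ , A.refl₁
    ; F-cmp = λ f g p q →
        C.trans₁ (π₁-++ (st f) (gs f) (gs g) _ (wf f) (ok₂ f g p) (q₁ _ _ _ (wf f) (ok₂ f g p)))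
                 (C.cmp-cong C.refl₁ (π₁-cong p (reflL (gs g)) _ (wf g)) _ (proj₁ q))
      , A.trans₁ (π₂-++ (st f) (gs f) (gs g) _ (wf f) (ok₂ f g p) (q₂ _ _ _ (wf f) (ok₂ f g p)))
                 (A.cmp-cong A.refl₁ (π₂-cong p (reflL (gs g)) _ (wf g)) _ (proj₂ q)) }
    where
      ok₂ : ∀ f g → tgtW (st f) (gs f) ≈O st g → WF (tgtW (st f) (gs f)) (gs g)
      ok₂ f g p = WF-cong (symO p) (reflL (gs g)) (wf g)

-- Given a category U, a 2-category P and a functor Φ : U → P (into the
-- underlying category of P), the 2-category with the objects and 1-cells
-- of U and with 2-cells f ⇒ g the 2-cells Φ f ⇒ Φ g of P (for parallel
-- f, g): the factorisation of Φ as identity-on-objects-and-1-cells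
-- followed by a locally fully faithful 2-functor.

module Full (U : Cat) (P : TwoCat) (Φ : CatFun U (TwoCat.cat P)) where
  private
    module U = Cat U
    module P = TwoCat P
    module Φ = CatFun Φ

  record FCell : Set where
    constructor fc
    field
      d c : U.Hom
      α   : P.Cell
      pd  : P.dom α P.≈₁ Φ.F₁ d
      pc  : P.cod α P.≈₁ Φ.F₁ c
      ps  : U.src d U.≈₀ U.src c
      pt  : U.tgt d U.≈₀ U.tgt c
  open FCell

  hq : ∀ (x y : FCell) → U.tgt (d x) U.≈₀ U.src (d y) → P.tgt (P.dom (α x)) P.≈₀ P.src (P.dom (α y))
  hq x y p = P.trans₀ (P.tgt-cong (pd x)) (P.trans₀ (Φ.F-tgt _) (P.trans₀ (Φ.F₀-cong p)
               (P.trans₀ (P.sym₀ (Φ.F-src _)) (P.sym₀ (P.src-cong (pd y))))))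

  hq' : ∀ (x y : FCell) → U.tgt (d x) U.≈₀ U.src (d y) → U.tgt (c x) U.≈₀ U.src (c y)
  hq' x y p = U.trans₀ (U.sym₀ (pt x)) (U.trans₀ p (ps y))

  qΦ : ∀ {f g} → U.tgt f U.≈₀ U.src g → P.tgt (Φ.F₁ f) P.≈₀ P.src (Φ.F₁ g)
  qΦ p = P.trans₀ (Φ.F-tgt _) (P.trans₀ (Φ.F₀-cong p) (P.sym₀ (Φ.F-src _)))

  idc' : U.Hom → FCell
  idc' f = fc f f (P.idc (Φ.F₁ f)) (P.dom-idc _) (P.cod-idc _) U.refl₀ U.refl₀

  vcmp' : (x y : FCell) → c x U.≈₁ d y → FCell
  vcmp' x y p = fc (d x) (c y)
    (P.vcmp (α x) (α y) (P.trans₁ (pc x) (P.trans₁ (Φ.F₁-cong p) (P.sym₁ (pd y)))))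
    (P.trans₁ (P.dom-vcmp _ _ _) (pd x))
    (P.trans₁ (P.cod-vcmp _ _ _) (pc y))
    (U.trans₀ (ps x) (U.trans₀ (U.src-cong p) (ps y)))
    (U.trans₀ (pt x) (U.trans₀ (U.tgt-cong p) (pt y)))

  hcmp' : (x y : FCell) → U.tgt (d x) U.≈₀ U.src (d y) → FCell
  hcmp' x y p = fc (U.cmp (d x) (d y) p) (U.cmp (c x) (c y) (hq' x y p))
    (P.hcmp (α x) (α y) (hq x y p))
    (P.trans₁ (P.dom-hcmp _ _ _ (hq x y p))
      (P.trans₁ (P.cmp-cong (pd x) (pd y) _ (qΦ p)) (P.sym₁ (Φ.F-cmp _ _ _ _))))
    (P.trans₁ (P.cod-hcmp _ _ _ (P.trans₀ (P.tgt-cong (pc x)) (P.trans₀ (qΦ (hq' x y p)) (P.sym₀ (P.src-cong (pc y))))))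
      (P.trans₁ (P.cmp-cong (pc x) (pc y) _ (qΦ (hq' x y p))) (P.sym₁ (Φ.F-cmp _ _ _ _))))
    (U.trans₀ (U.src-cmp _ _ _) (U.trans₀ (ps x) (U.sym₀ (U.src-cmp _ _ _))))
    (U.trans₀ (U.tgt-cmp _ _ _) (U.trans₀ (pt y) (U.sym₀ (U.tgt-cmp _ _ _))))

  _≈F_ : FCell → FCell → Set
  x ≈F y = (d x U.≈₁ d y) × (c x U.≈₁ c y) × (α x P.≈₂ α y)

  FullTwo : TwoCat
  FullTwo = record
    { cat = U
    ; Cell = FCell
    ; _≈₂_ = _≈F_
    ; isEq₂ = record
        { refl = U.refl₁ , U.refl₁ , P.refl₂
        ; sym = λ { (a , b , e) → U.sym₁ a , U.sym₁ b , P.sym₂ e }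
        ; trans = λ { (a , b , e) (a' , b' , e') → U.trans₁ a a' , U.trans₁ b b' , P.trans₂ e e' } }
    ; dom = d
    ; cod = c
    ; dom-cong = proj₁
    ; cod-cong = λ e → proj₁ (proj₂ e)
    ; glob-src = ps
    ; glob-tgt = pt
    ; idc = idc'
    ; idc-cong = λ e → e , e , P.idc-cong (Φ.F₁-cong e)
    ; dom-idc = λ _ → U.refl₁
    ; cod-idc = λ _ → U.refl₁
    ; vcmp = vcmp'
    ; vcmp-cong = λ { (a , b , e) (a' , b' , e') p p' → a , b' , P.vcmp-cong e e' _ _ }
    ; dom-vcmp = λ _ _ _ → U.refl₁
    ; cod-vcmp = λ _ _ _ → U.refl₁
    ; vidˡ = λ x p → U.refl₁ , U.refl₁ ,
        P.trans₂ (P.vcmp-cong (P.idc-cong (P.sym₁ (pd x))) P.refl₂ _ (P.cod-idc _)) (P.vidˡ _ _)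
    ; vidʳ = λ x p → U.refl₁ , U.refl₁ ,
        P.trans₂ (P.vcmp-cong P.refl₂ (P.idc-cong (P.sym₁ (pc x))) _ (P.sym₁ (P.dom-idc _))) (P.vidʳ _ _)
    ; vassoc = λ x y z p q r s → U.refl₁ , U.refl₁ , P.vassoc _ _ _ _ _ _ _
    ; hcmp = hcmp'
    ; hcmp-cong = λ { (a , b , e) (a' , b' , e') p p' →
        U.cmp-cong a a' _ _ , U.cmp-cong b b' _ _ , P.hcmp-cong e e' _ _ }
    ; dom-hcmp = λ x y p q → U.cmp-cong U.refl₁ U.refl₁ _ _
    ; cod-hcmp = λ x y p q → U.cmp-cong U.refl₁ U.refl₁ _ _
    ; hidˡ = λ x p →
        U.idˡ _ _ ,
        U.trans₁ (U.cmp-cong (U.idn-cong (ps x)) U.refl₁ _ (U.tgt-idn _)) (U.idˡ _ _) ,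
        P.trans₂ (P.hcmp-cong (P.idc-cong
                    (P.trans₁ (Φ.F-idn _) (P.idn-cong (P.sym₀ (P.trans₀ (P.src-cong (pd x)) (Φ.F-src _))))))
                   P.refl₂ _ (P.trans₀ (P.tgt-cong (P.dom-idc _)) (P.tgt-idn _)))
          (P.hidˡ _ _)
    ; hidʳ = λ x p →
        U.idʳ _ _ ,
        U.trans₁ (U.cmp-cong U.refl₁ (U.idn-cong (pt x)) _ (U.sym₀ (U.src-idn _))) (U.idʳ _ _) ,
        P.trans₂ (P.hcmp-cong P.refl₂ (P.idc-cong
                    (P.trans₁ (Φ.F-idn _) (P.idn-cong (P.sym₀ (P.trans₀ (P.tgt-cong (pd x)) (Φ.F-tgt _))))))
                   _ (P.sym₀ (P.trans₀ (P.src-cong (P.dom-idc _)) (P.src-idn _))))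
          (P.hidʳ _ _)
    ; hassoc = λ x y z p q r s → U.assoc _ _ _ _ _ _ _ , U.assoc _ _ _ _ _ _ _ , P.hassoc _ _ _ _ _ _ _
    ; hcmp-idc = λ f g p q → U.cmp-cong U.refl₁ U.refl₁ _ _ , U.cmp-cong U.refl₁ U.refl₁ _ _ ,
        P.trans₂ (P.hcmp-idc _ _ _ (qΦ q)) (P.idc-cong (P.sym₁ (Φ.F-cmp _ _ _ _)))
    ; interchange = λ x y z w p q r s t u →
        U.cmp-cong U.refl₁ U.refl₁ _ _ , U.cmp-cong U.refl₁ U.refl₁ _ _ , P.interchange _ _ _ _ _ _ _ _ _ _ }

module FullMap (U U' : Cat) (P P' : TwoCat)
               (Φ : CatFun U (TwoCat.cat P)) (Φ' : CatFun U' (TwoCat.cat P'))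
               (H : CatFun U U') (K : Fun P P')
               (comm : ∀ f → TwoCat._≈₁_ P' (CatFun.F₁ Φ' (CatFun.F₁ H f)) (Fun.F₁ K (CatFun.F₁ Φ f))) where
  private
    module U = Cat U
    module U' = Cat U'
    module P = TwoCat P
    module P' = TwoCat P'
    module H = CatFun H
    module K = Fun K
    module X = Full U P Φ
    module Y = Full U' P' Φ'
  open X.FCell

  map₂ : X.FCell → Y.FCell
  map₂ x = Y.fc (H.F₁ (d x)) (H.F₁ (c x)) (K.F₂ (α x))
    (P'.trans₁ (K.F-dom _) (P'.trans₁ (K.F₁-cong (pd x)) (P'.sym₁ (comm _))))
    (P'.trans₁ (K.F-cod _) (P'.trans₁ (K.F₁-cong (pc x)) (P'.sym₁ (comm _))))
    (U'.trans₀ (H.F-src _) (U'.trans₀ (H.F₀-cong (ps x)) (U'.sym₀ (H.F-src _))))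
    (U'.trans₀ (H.F-tgt _) (U'.trans₀ (H.F₀-cong (pt x)) (U'.sym₀ (H.F-tgt _))))

  mapFun : Fun X.FullTwo Y.FullTwo
  mapFun = record
    { F = H
    ; F₂ = map₂
    ; F₂-cong = λ { (a , b , e) → H.F₁-cong a , H.F₁-cong b , K.F₂-cong e }
    ; F-dom = λ _ → U'.refl₁
    ; F-cod = λ _ → U'.refl₁
    ; F-idc = λ f → U'.refl₁ , U'.refl₁ , P'.trans₂ (K.F-idc _) (P'.idc-cong (P'.sym₁ (comm f)))
    ; F-vcmp = λ x y p q → U'.refl₁ , U'.refl₁ , K.F-vcmp _ _ _ _
    ; F-hcmp = λ x y p q → H.F-cmp _ _ _ _ , H.F-cmp _ _ _ _ , K.F-hcmp _ _ _ _ }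

module FunnyMap (C A B : Cat) (F : CatFun A B) where
  private
    module C = Cat C
    module A = Cat A
    module B = Cat B
    module F = CatFun F
    module X = Funny C A
    module Y = Funny C B

  mapO : X.Ob → Y.Ob
  mapO x = proj₁ x , F.F₀ (proj₂ x)

  mapG : X.Gen → Y.Gen
  mapG (inj₁ c) = inj₁ c
  mapG (inj₂ d) = inj₂ (F.F₁ d)

  mapL : List X.Gen → List Y.Gen
  mapL = map mapG

  step-map : ∀ x g → Y.step (mapO x) (mapG g) Y.≈O mapO (X.step x g)
  step-map x (inj₁ c) = Y.reflO
  step-map x (inj₂ d) = C.refl₀ , F.F-tgt d

  tgt-map : ∀ x u → Y.tgtW (mapO x) (mapL u) Y.≈O mapO (X.tgtW x u)
  tgt-map x [] = Y.reflO
  tgt-map x (g ∷ u) = Y.transO (Y.tgtW-cong (step-map x g) (Y.reflL (mapL u))) (tgt-map (X.step x g) u)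

  WF-map : ∀ x u → X.WF x u → Y.WF (mapO x) (mapL u)
  WF-map x [] _ = tt
  WF-map x (inj₁ c ∷ u) (e , ok) =
    e , Y.WF-cong (Y.symO (step-map x (inj₁ c))) (Y.reflL (mapL u)) (WF-map _ u ok)
  WF-map x (inj₂ d ∷ u) (e , ok) =
    B.trans₀ (F.F-src d) (F.F₀-cong e) ,
    Y.WF-cong (Y.symO (step-map x (inj₂ d))) (Y.reflL (mapL u)) (WF-map _ u ok)

  G-map : ∀ {g g'} → g X.≈G g' → mapG g Y.≈G mapG g'
  G-map (X.g₁ e) = Y.g₁ e
  G-map (X.g₂ e) = Y.g₂ (F.F₁-cong e)

  L-map : ∀ {u u'} → u X.≈L u' → mapL u Y.≈L mapL u'
  L-map X.[] = Y.[]
  L-map (e X.∷ l) = G-map e Y.∷ L-map l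

  R-map : ∀ {x u y v} → X.R x u y v → Y.R (mapO x) (mapL u) (mapO y) (mapL v)
  R-map X.~refl = Y.~refl
  R-map (X.~sym r) = Y.~sym (R-map r)
  R-map (X.~trans r s) = Y.~trans (R-map r) (R-map s)
  R-map (X.~cong e l) = Y.~cong (proj₁ e , F.F₀-cong (proj₂ e)) (L-map l)
  R-map (X.~app {x} {u} {x'} {u'} {v} {v'} r s)
    rewrite map-++ mapG u v | map-++ mapG u' v' =
    Y.~app (R-map r)
      (Y.~trans (Y.~cong (tgt-map x u) (Y.reflL (mapL v)))
        (Y.~trans (R-map s) (Y.~cong (Y.symO (tgt-map x' u')) (Y.reflL (mapL v')))))
  R-map (X.~cmp₁ x c c' p) = Y.~cmp₁ (mapO x) c c' p
  R-map (X.~idn₁ x z e) = Y.~idn₁ (mapO x) z e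
  R-map (X.~cmp₂ x d d' p) =
    Y.~trans (Y.~cmp₂ (mapO x) (F.F₁ d) (F.F₁ d') q)
             (Y.~cong Y.reflO (Y.g₂ (B.sym₁ (F.F-cmp d d' p q)) Y.∷ Y.[]))
    where q = B.trans₀ (F.F-tgt d) (B.trans₀ (F.F₀-cong p) (B.sym₀ (F.F-src d')))
  R-map (X.~idn₂ x z e) =
    Y.~trans (Y.~cong Y.reflO (Y.g₂ (F.F-idn z) Y.∷ Y.[])) (Y.~idn₂ (mapO x) (F.F₀ z) (F.F₀-cong e))

  funnyMap : CatFun X.FunnyCat Y.FunnyCat
  funnyMap = record
    { F₀ = mapO
    ; F₀-cong = λ e → proj₁ e , F.F₀-cong (proj₂ e)
    ; F₁ = λ f → Y.w (mapO (X.st f)) (mapL (X.gs f)) (WF-map _ _ (X.wf f))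
    ; F₁-cong = R-map
    ; F-src = λ _ → Y.reflO
    ; F-tgt = λ f → tgt-map (X.st f) (X.gs f)
    ; F-idn = λ _ → Y.~refl
    ; F-cmp = λ f g p q → Y.~cong Y.reflO (Y.≡⇒≈L (map-++ mapG (X.gs f) (X.gs g))) }

  πm₁ : ∀ x u ok ok' → Y.π₁ (mapO x) (mapL u) ok' C.≈₁ X.π₁ x u ok
  πm₁ x [] _ _ = C.refl₁
  πm₁ x (inj₁ c ∷ u) (_ , ok) (_ , ok') =
    C.cmp-cong C.refl₁ (C.trans₁ (Y.π₁-cong (step-map x (inj₁ c)) (Y.reflL (mapL u)) ok' (WF-map _ u ok))
                                 (πm₁ _ u ok _)) _ _
  πm₁ x (inj₂ d ∷ u) (_ , ok) (_ , ok') =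
    C.trans₁ (Y.π₁-cong (step-map x (inj₂ d)) (Y.reflL (mapL u)) ok' (WF-map _ u ok)) (πm₁ _ u ok _)

  πm₂ : ∀ x u ok ok' → Y.π₂ (mapO x) (mapL u) ok' B.≈₁ F.F₁ (X.π₂ x u ok)
  πm₂ x [] _ _ = B.sym₁ (F.F-idn _)
  πm₂ x (inj₁ c ∷ u) (_ , ok) (_ , ok') =
    B.trans₁ (Y.π₂-cong (step-map x (inj₁ c)) (Y.reflL (mapL u)) ok' (WF-map _ u ok)) (πm₂ _ u ok _)
  πm₂ x (inj₂ d ∷ u) (_ , ok) (_ , ok') =
    B.trans₁ (B.cmp-cong B.refl₁ (B.trans₁ (Y.π₂-cong (step-map x (inj₂ d)) (Y.reflL (mapL u)) ok' (WF-map _ u ok))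
                                 (πm₂ _ u ok _)) _ (B.trans₀ (F.F-tgt d) (B.sym₀ (B.trans₀ (F.F-src _) (F.F₀-cong (X.π₂-src _ u ok))))))
      (B.sym₁ (F.F-cmp _ _ _ _))

Gray : TwoCat → TwoCat → TwoCat
Gray C A = Full.FullTwo (Funny.FunnyCat C.cat A.cat) (C ×₂ A) (Funny.Π C.cat A.cat)
  where
    module C = TwoCat C
    module A = TwoCat A

infixr 7 _⊠_ _⊠F_
_⊠_ : TwoCat → TwoCat → TwoCat
C ⊠ A = Gray C A

_⊠F_ : ∀ (C : TwoCat) {A B} → Fun A B → Fun (C ⊠ A) (C ⊠ B)
_⊠F_ C {A} {B} F =
  FullMap.mapFun (Funny.FunnyCat C.cat A.cat) (Funny.FunnyCat C.cat B.cat) (C ×₂ A) (C ×₂ B)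
    (Funny.Π C.cat A.cat) (Funny.Π C.cat B.cat) (M.funnyMap) (prodMap C F)
    (λ f → M.πm₁ (Funny.st f) (Funny.gs f) (Funny.wf f) _ , M.πm₂ (Funny.st f) (Funny.gs f) (Funny.wf f) _)
  where
    module C = TwoCat C
    module A = TwoCat A
    module B = TwoCat B
    module M = FunnyMap C.cat A.cat B.cat (Fun.F F)

{-# OPTIONS --safe #-}
module Submission where

-- A 1-cell of 𝒞 ⊠ 𝒜 is a word in generators from 𝒞 and 𝒜. Orienting the
-- relations (merge adjacent generators of the same kind, drop identities) gives a
-- terminating, locally confluent rewriting system, so equal words have ≈-equal
-- reducts. As S retracts F and G, both reflect ≈, and reductions of an image word
-- lift to reductions of the word. So if the images of a word under 𝒞 ⊠ F and
-- 𝒞 ⊠ G are equal, it reduces to a word each of whose 𝒜-letters a has F a ≈ G a,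
-- and such letters lift along the equalizer E; 2-cells, being pairs of 2-cells
-- between projections, lift componentwise. Since E is monic it reflects ≈, hence
-- so does 𝒞 ⊠ E: this makes the pointwise lift a 2-functor and gives uniqueness.

open import Defs
open import Data.Empty using (⊥-elim)
open import Data.Nat using (zero; suc; _≤_; _<_; s≤s; s≤s⁻¹)
open import Data.Nat.Properties using (≤-refl; ≤-trans; n≮0)
open import Data.Product using (Σ; ∃-syntax; _×_; _,_; proj₁; proj₂)
open import Data.Sum using (inj₁; inj₂)
open import Data.List using (List; []; _∷_; _++_; length)
open import Relation.Binary.Construct.Closure.ReflexiveTransitive
  using (Star; ε; _◅_; _◅◅_; gmap; return)

module CatProperties (C : Cat) where
  open Cat C

  composable-cong : ∀ {f f' g g'} → f ≈₁ f' → g ≈₁ g' → tgt f ≈₀ src g → tgt f' ≈₀ src g'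
  composable-cong e e' p = trans₀ (sym₀ (tgt-cong e)) (trans₀ p (src-cong e'))

  src-≈idn : ∀ {f z} → f ≈₁ idn z → src f ≈₀ z
  src-≈idn e = trans₀ (src-cong e) (src-idn _)

  tgt-≈idn : ∀ {f z} → f ≈₁ idn z → tgt f ≈₀ z
  tgt-≈idn e = trans₀ (tgt-cong e) (tgt-idn _)

  cmp-identityˡ : ∀ {f g z} → f ≈₁ idn z → (p : tgt f ≈₀ src g) → cmp f g p ≈₁ g
  cmp-identityˡ {g = g} e p =
    trans₁ (cmp-cong (trans₁ e (idn-cong (trans₀ (sym₀ (tgt-≈idn e)) p))) refl₁ p (tgt-idn _))
           (idˡ g _)

  cmp-identityʳ : ∀ {f g z} → g ≈₁ idn z → (p : tgt f ≈₀ src g) → cmp f g p ≈₁ f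
  cmp-identityʳ {f = f} e p =
    trans₁ (cmp-cong refl₁ (trans₁ e (idn-cong (trans₀ (sym₀ (src-≈idn e)) (sym₀ p)))) p
                     (sym₀ (src-idn _)))
           (idʳ f _)

module WordRewriting (C A : Cat) where
  open Funny C A
  private
    module C = Cat C
    module A = Cat A
    module CP = CatProperties C
    module AP = CatProperties A

  ≈G-trans : ∀ {g g' g''} → g ≈G g' → g' ≈G g'' → g ≈G g''
  ≈G-trans (g₁ e) (g₁ e') = g₁ (C.trans₁ e e')
  ≈G-trans (g₂ e) (g₂ e') = g₂ (A.trans₁ e e')

  ≈L-trans : ∀ {u u' u''} → u ≈L u' → u' ≈L u'' → u ≈L u''
  ≈L-trans [] [] = []
  ≈L-trans (e ∷ l) (e' ∷ l') = ≈G-trans e e' ∷ ≈L-trans l l'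

  ≈L-++ : ∀ {u u' v v'} → u ≈L u' → v ≈L v' → (u ++ v) ≈L (u' ++ v')
  ≈L-++ [] m = m
  ≈L-++ (e ∷ l) m = e ∷ ≈L-++ l m

  infix 4 _↝_ _↝*_
  data _↝_ : List Gen → List Gen → Set where
    merge₁ : ∀ {c c' u} (p : C.tgt c C.≈₀ C.src c') →
             (inj₁ c ∷ inj₁ c' ∷ u) ↝ (inj₁ (C.cmp c c' p) ∷ u)
    merge₂ : ∀ {a a' u} (p : A.tgt a A.≈₀ A.src a') →
             (inj₂ a ∷ inj₂ a' ∷ u) ↝ (inj₂ (A.cmp a a' p) ∷ u)
    drop₁  : ∀ {c u} z → c C.≈₁ C.idn z → (inj₁ c ∷ u) ↝ u
    drop₂  : ∀ {a u} z → a A.≈₁ A.idn z → (inj₂ a ∷ u) ↝ u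
    there  : ∀ {g u v} → u ↝ v → (g ∷ u) ↝ (g ∷ v)

  _↝*_ : List Gen → List Gen → Set
  _↝*_ = Star _↝_

  ↝*-there : ∀ {g u v} → u ↝* v → (g ∷ u) ↝* (g ∷ v)
  ↝*-there {g} = gmap (g ∷_) there

  ↝*-++ˡ : ∀ q {u v} → u ↝* v → (q ++ u) ↝* (q ++ v)
  ↝*-++ˡ [] r = r
  ↝*-++ˡ (g ∷ q) r = ↝*-there (↝*-++ˡ q r)

  ↝-++ʳ : ∀ q {u v} → u ↝ v → (u ++ q) ↝ (v ++ q)
  ↝-++ʳ _ (merge₁ p) = merge₁ p
  ↝-++ʳ _ (merge₂ p) = merge₂ p
  ↝-++ʳ _ (drop₁ z e) = drop₁ z e
  ↝-++ʳ _ (drop₂ z e) = drop₂ z e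
  ↝-++ʳ q (there s) = there (↝-++ʳ q s)

  ↝*-++ʳ : ∀ q {u v} → u ↝* v → (u ++ q) ↝* (v ++ q)
  ↝*-++ʳ q = gmap (_++ q) (↝-++ʳ q)

  ↝-resp-≈L : ∀ {u u' v} → u ≈L u' → u ↝ v → ∃[ v' ] (u' ↝ v' × v ≈L v')
  ↝-resp-≈L (g₁ e ∷ g₁ e' ∷ l) (merge₁ p) =
    _ , merge₁ (CP.composable-cong e e' p) , g₁ (C.cmp-cong e e' _ _) ∷ l
  ↝-resp-≈L (g₂ e ∷ g₂ e' ∷ l) (merge₂ p) =
    _ , merge₂ (AP.composable-cong e e' p) , g₂ (A.cmp-cong e e' _ _) ∷ l
  ↝-resp-≈L (g₁ e ∷ l) (drop₁ z e₀) = _ , drop₁ z (C.trans₁ (C.sym₁ e) e₀) , l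
  ↝-resp-≈L (g₂ e ∷ l) (drop₂ z e₀) = _ , drop₂ z (A.trans₁ (A.sym₁ e) e₀) , l
  ↝-resp-≈L (e ∷ l) (there s) with ↝-resp-≈L l s
  ... | _ , s' , l' = _ , there s' , e ∷ l'

  ↝*-resp-≈L : ∀ {u u' v} → u ≈L u' → u ↝* v → ∃[ v' ] (u' ↝* v' × v ≈L v')
  ↝*-resp-≈L l ε = _ , ε , l
  ↝*-resp-≈L l (s ◅ r) with ↝-resp-≈L l s
  ... | _ , s' , l' with ↝*-resp-≈L l' r
  ... | _ , r' , l'' = _ , s' ◅ r' , l''

  data Joinable (u v : List Gen) : Set where
    join : ∀ {u' v'} → u ↝* u' → v ↝* v' → u' ≈L v' → Joinable u v

  ≈L⇒Joinable : ∀ {u v} → u ≈L v → Joinable u v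
  ≈L⇒Joinable = join ε ε

  Joinable-sym : ∀ {u v} → Joinable u v → Joinable v u
  Joinable-sym (join r s e) = join s r (symL e)

  merge₁-confluent : ∀ {c c' u w} (p : C.tgt c C.≈₀ C.src c') →
                     (inj₁ c ∷ inj₁ c' ∷ u) ↝ w → Joinable (inj₁ (C.cmp c c' p) ∷ u) w
  merge₁-confluent p (merge₁ p') = ≈L⇒Joinable (g₁ (C.cmp-cong C.refl₁ C.refl₁ p p') ∷ reflL _)
  merge₁-confluent p (drop₁ _ e) = ≈L⇒Joinable (g₁ (CP.cmp-identityˡ e p) ∷ reflL _)
  merge₁-confluent p (there (drop₁ _ e)) = ≈L⇒Joinable (g₁ (CP.cmp-identityʳ e p) ∷ reflL _)
  merge₁-confluent {c} {c'} p (there (merge₁ {c' = c''} p')) =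
    join (return (merge₁ (C.trans₀ (C.tgt-cmp c c' p) p')))
         (return (merge₁ (C.trans₀ p (C.sym₀ (C.src-cmp c' c'' p')))))
         (g₁ (C.assoc c c' c'' p p' _ _) ∷ reflL _)
  merge₁-confluent p (there (there s)) = join (return (there s)) (return (merge₁ p)) (reflL _)

  merge₂-confluent : ∀ {a a' u w} (p : A.tgt a A.≈₀ A.src a') →
                     (inj₂ a ∷ inj₂ a' ∷ u) ↝ w → Joinable (inj₂ (A.cmp a a' p) ∷ u) w
  merge₂-confluent p (merge₂ p') = ≈L⇒Joinable (g₂ (A.cmp-cong A.refl₁ A.refl₁ p p') ∷ reflL _)
  merge₂-confluent p (drop₂ _ e) = ≈L⇒Joinable (g₂ (AP.cmp-identityˡ e p) ∷ reflL _)
  merge₂-confluent p (there (drop₂ _ e)) = ≈L⇒Joinable (g₂ (AP.cmp-identityʳ e p) ∷ reflL _)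
  merge₂-confluent {a} {a'} p (there (merge₂ {a' = a''} p')) =
    join (return (merge₂ (A.trans₀ (A.tgt-cmp a a' p) p')))
         (return (merge₂ (A.trans₀ p (A.sym₀ (A.src-cmp a' a'' p')))))
         (g₂ (A.assoc a a' a'' p p' _ _) ∷ reflL _)
  merge₂-confluent p (there (there s)) = join (return (there s)) (return (merge₂ p)) (reflL _)

  drop₁-confluent : ∀ {c u w} z → c C.≈₁ C.idn z → (inj₁ c ∷ u) ↝ w → Joinable u w
  drop₁-confluent z e (merge₁ p) = Joinable-sym (merge₁-confluent p (drop₁ z e))
  drop₁-confluent z e (drop₁ _ _) = ≈L⇒Joinable (reflL _)
  drop₁-confluent z e (there s) = join (return s) (return (drop₁ z e)) (reflL _)

  drop₂-confluent : ∀ {a u w} z → a A.≈₁ A.idn z → (inj₂ a ∷ u) ↝ w → Joinable u w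
  drop₂-confluent z e (merge₂ p) = Joinable-sym (merge₂-confluent p (drop₂ z e))
  drop₂-confluent z e (drop₂ _ _) = ≈L⇒Joinable (reflL _)
  drop₂-confluent z e (there s) = join (return s) (return (drop₂ z e)) (reflL _)

  ↝-locally-confluent : ∀ {u v w} → u ↝ v → u ↝ w → Joinable v w
  ↝-locally-confluent (merge₁ p) t = merge₁-confluent p t
  ↝-locally-confluent (merge₂ p) t = merge₂-confluent p t
  ↝-locally-confluent (drop₁ z e) t = drop₁-confluent z e t
  ↝-locally-confluent (drop₂ z e) t = drop₂-confluent z e t
  ↝-locally-confluent (there s) (merge₁ p) = Joinable-sym (merge₁-confluent p (there s))
  ↝-locally-confluent (there s) (merge₂ p) = Joinable-sym (merge₂-confluent p (there s))
  ↝-locally-confluent (there s) (drop₁ z e) = Joinable-sym (drop₁-confluent z e (there s))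
  ↝-locally-confluent (there s) (drop₂ z e) = Joinable-sym (drop₂-confluent z e (there s))
  ↝-locally-confluent (there {g} s) (there t) with ↝-locally-confluent s t
  ... | join r r' l = join (↝*-there r) (↝*-there r') (reflG g ∷ l)

  ↝-shrinks : ∀ {u v} → u ↝ v → length v < length u
  ↝-shrinks (merge₁ _) = ≤-refl
  ↝-shrinks (merge₂ _) = ≤-refl
  ↝-shrinks (drop₁ _ _) = ≤-refl
  ↝-shrinks (drop₂ _ _) = ≤-refl
  ↝-shrinks (there s) = s≤s (↝-shrinks s)

  -- Newman's lemma with joins up to ≈L (the library version joins up to ≡),
  -- by induction on a bound for the length of the source word.
  ↝*-confluent-below : ∀ n {u} → length u ≤ n → ∀ {v w} → u ↝* v → u ↝* w → Joinable v w
  ↝*-confluent-below _ _ ε r = join r ε (reflL _)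
  ↝*-confluent-below _ _ (s ◅ r) ε = join ε (s ◅ r) (reflL _)
  ↝*-confluent-below zero b (s ◅ _) (_ ◅ _) = ⊥-elim (n≮0 (≤-trans (↝-shrinks s) b))
  ↝*-confluent-below (suc n) b (s ◅ r₁) (t ◅ r₂)
    with ↝-locally-confluent s t
  ... | join s₁ t₁ e₁
    with ↝*-confluent-below n (s≤s⁻¹ (≤-trans (↝-shrinks s) b)) r₁ s₁
  ... | join r₁' s₂ e₂
    with ↝*-resp-≈L e₁ s₂
  ... | _ , t₂ , e₃
    with ↝*-confluent-below n (s≤s⁻¹ (≤-trans (↝-shrinks t) b)) r₂ (t₁ ◅◅ t₂)
  ... | join r₂' t₃ e₄
    with ↝*-resp-≈L (symL (≈L-trans e₂ e₃)) t₃
  ... | _ , r₃ , e₅ = join (r₁' ◅◅ r₃) r₂' (≈L-trans (symL e₅) (symL e₄))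

  ↝*-confluent : ∀ {u v w} → u ↝* v → u ↝* w → Joinable v w
  ↝*-confluent {u} = ↝*-confluent-below (length u) ≤-refl

  Joinable-trans : ∀ {u v w} → Joinable u v → Joinable v w → Joinable u w
  Joinable-trans (join r₁ r₂ e) (join r₃ r₄ e') with ↝*-confluent r₂ r₃
  ... | join r₅ r₆ e'' with ↝*-resp-≈L (symL e) r₅ | ↝*-resp-≈L e' r₆
  ... | _ , r₇ , e₇ | _ , r₈ , e₈ =
    join (r₁ ◅◅ r₇) (r₄ ◅◅ r₈) (≈L-trans (symL e₇) (≈L-trans e'' e₈))

  Joinable-++ : ∀ {u u' v v'} → Joinable u u' → Joinable v v' → Joinable (u ++ v) (u' ++ v')
  Joinable-++ {v = v} {v'} (join {a} {a'} r r' e) (join s s' e') =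
    join (↝*-++ʳ v r ◅◅ ↝*-++ˡ a s) (↝*-++ʳ v' r' ◅◅ ↝*-++ˡ a' s') (≈L-++ e e')

  R⇒Joinable : ∀ {x u y v} → R x u y v → Joinable u v
  R⇒Joinable ~refl = ≈L⇒Joinable (reflL _)
  R⇒Joinable (~sym r) = Joinable-sym (R⇒Joinable r)
  R⇒Joinable (~trans r r') = Joinable-trans (R⇒Joinable r) (R⇒Joinable r')
  R⇒Joinable (~cong _ l) = ≈L⇒Joinable l
  R⇒Joinable (~app r r') = Joinable-++ (R⇒Joinable r) (R⇒Joinable r')
  R⇒Joinable (~cmp₁ _ _ _ p) = join (return (merge₁ p)) ε (reflL _)
  R⇒Joinable (~idn₁ _ z _) = join (return (drop₁ z C.refl₁)) ε (reflL _)
  R⇒Joinable (~cmp₂ _ _ _ p) = join (return (merge₂ p)) ε (reflL _)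
  R⇒Joinable (~idn₂ _ z _) = join (return (drop₂ z A.refl₁)) ε (reflL _)

  R-++ʳ : ∀ {x u x' u'} → R x u x' u' → ∀ v → R x (u ++ v) x' (u' ++ v)
  R-++ʳ r v = ~app r (~cong (R-tgt r) (reflL v))

  ↝⇒R : ∀ {x u v} → WF x u → u ↝ v → R x u x v
  ↝⇒R {x} _ (merge₁ {u = u} p) = R-++ʳ (~cmp₁ x _ _ p) u
  ↝⇒R {x} _ (merge₂ {u = u} p) = R-++ʳ (~cmp₂ x _ _ p) u
  ↝⇒R {x} (ok , _) (drop₁ {u = u} z e) =
    R-++ʳ (~trans (~cong reflO (g₁ e ∷ [])) (~idn₁ x z (C.trans₀ (C.sym₀ (CP.src-≈idn e)) ok))) u
  ↝⇒R {x} (ok , _) (drop₂ {u = u} z e) =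
    R-++ʳ (~trans (~cong reflO (g₂ e ∷ [])) (~idn₂ x z (A.trans₀ (A.sym₀ (AP.src-≈idn e)) ok))) u
  ↝⇒R (_ , ok) (there {g} s) = ~app {u = g ∷ []} {u' = g ∷ []} ~refl (↝⇒R ok s)

  ↝*⇒R : ∀ {x u v} → WF x u → u ↝* v → R x u x v
  ↝*⇒R ok ε = ~refl
  ↝*⇒R ok (s ◅ r) = ~trans (↝⇒R ok s) (↝*⇒R (proj₁ (R-WF (↝⇒R ok s)) ok) r)

  ↝*-preserves-WF : ∀ {x u v} → WF x u → u ↝* v → WF x v
  ↝*-preserves-WF ok r = proj₁ (R-WF (↝*⇒R ok r)) ok

  Joinable⇒R : ∀ {x u y v} → x ≈O y → WF x u → WF y v → Joinable u v → R x u y v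
  Joinable⇒R e ok ok' (join r s l) = ~trans (↝*⇒R ok r) (~trans (~cong e l) (~sym (↝*⇒R ok' s)))

module _ {C D : Cat} where
  private
    module C = Cat C
    module D = Cat D

  record CatFunReflects (Φ : CatFun C D) : Set where
    field
      reflect₀ : ∀ {x y} → CatFun.F₀ Φ x D.≈₀ CatFun.F₀ Φ y → x C.≈₀ y
      reflect₁ : ∀ {f g} → CatFun.F₁ Φ f D.≈₁ CatFun.F₁ Φ g → f C.≈₁ g

module WordLifting (C A' A : Cat) (Φ : CatFun A' A) (Φ-reflects : CatFunReflects Φ) where
  open FunnyMap C A' A Φ
  open CatFunReflects Φ-reflects
  private
    module C = Cat C
    module A = Cat A
    module A' = Cat A'
    module Φ = CatFun Φ
    module CP = CatProperties C
    module AP = CatProperties A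
    module X = Funny C A'
    module Y = Funny C A
    module RX = WordRewriting C A'
    module RY = WordRewriting C A

  reflect-identity : ∀ {a z} → Φ.F₁ a A.≈₁ A.idn z → a A'.≈₁ A'.idn (A'.src a)
  reflect-identity {a} e =
    reflect₁ (A.trans₁ e (A.trans₁ (A.idn-cong (A.trans₀ (A.sym₀ (AP.src-≈idn e)) (Φ.F-src a)))
                                   (A.sym₁ (Φ.F-idn _))))

  ↝-lift : ∀ {v v' u} → v Y.≈L mapL u → v RY.↝ v' → ∃[ u' ] (u RX.↝ u' × v' Y.≈L mapL u')
  ↝-lift {u = inj₁ _ ∷ inj₁ _ ∷ _} (Y.g₁ e Y.∷ (Y.g₁ e' Y.∷ l)) (RY.merge₁ p) =
    _ , RX.merge₁ (CP.composable-cong e e' p) , Y.g₁ (C.cmp-cong e e' _ _) Y.∷ l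
  ↝-lift {u = inj₁ _ ∷ inj₂ _ ∷ _} (_ Y.∷ (() Y.∷ _)) (RY.merge₁ _)
  ↝-lift {u = inj₂ _ ∷ _} (() Y.∷ _) (RY.merge₁ _)
  ↝-lift {u = inj₂ a ∷ inj₂ a' ∷ _} (Y.g₂ e Y.∷ (Y.g₂ e' Y.∷ l)) (RY.merge₂ p) =
    _ , RX.merge₂ p' , Y.g₂ (A.trans₁ (A.cmp-cong e e' p q) (A.sym₁ (Φ.F-cmp a a' p' q))) Y.∷ l
    where
      q = AP.composable-cong e e' p
      p' = reflect₀ (A.trans₀ (A.sym₀ (Φ.F-tgt a)) (A.trans₀ q (Φ.F-src a')))
  ↝-lift {u = inj₂ _ ∷ inj₁ _ ∷ _} (_ Y.∷ (() Y.∷ _)) (RY.merge₂ _)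
  ↝-lift {u = inj₁ _ ∷ _} (() Y.∷ _) (RY.merge₂ _)
  ↝-lift {u = inj₁ _ ∷ _} (Y.g₁ e Y.∷ l) (RY.drop₁ z e₀) =
    _ , RX.drop₁ z (C.trans₁ (C.sym₁ e) e₀) , l
  ↝-lift {u = inj₂ _ ∷ _} (() Y.∷ _) (RY.drop₁ _ _)
  ↝-lift {u = inj₂ a ∷ _} (Y.g₂ e Y.∷ l) (RY.drop₂ _ e₀) =
    _ , RX.drop₂ (A'.src a) (reflect-identity (A.trans₁ (A.sym₁ e) e₀)) , l
  ↝-lift {u = inj₁ _ ∷ _} (() Y.∷ _) (RY.drop₂ _ _)
  ↝-lift {u = _ ∷ _} (e Y.∷ l) (RY.there s) with ↝-lift l s
  ... | _ , s' , l' = _ , RX.there s' , e Y.∷ l'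

  ↝*-lift : ∀ {v v' u} → v Y.≈L mapL u → v RY.↝* v' → ∃[ u' ] (u RX.↝* u' × v' Y.≈L mapL u')
  ↝*-lift l ε = _ , ε , l
  ↝*-lift l (s ◅ r) with ↝-lift l s
  ... | _ , s' , l' with ↝*-lift l' r
  ... | _ , r' , l'' = _ , s' ◅ r' , l''

  mapL-reflects-≈L : ∀ {u u'} → mapL u Y.≈L mapL u' → u X.≈L u'
  mapL-reflects-≈L {[]} {[]} Y.[] = X.[]
  mapL-reflects-≈L {inj₁ _ ∷ _} {inj₁ _ ∷ _} (Y.g₁ e Y.∷ l) = X.g₁ e X.∷ mapL-reflects-≈L l
  mapL-reflects-≈L {inj₂ _ ∷ _} {inj₂ _ ∷ _} (Y.g₂ e Y.∷ l) = X.g₂ (reflect₁ e) X.∷ mapL-reflects-≈L l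
  mapL-reflects-≈L {inj₁ _ ∷ _} {inj₂ _ ∷ _} (() Y.∷ _)
  mapL-reflects-≈L {inj₂ _ ∷ _} {inj₁ _ ∷ _} (() Y.∷ _)

  mapO-reflects-≈O : ∀ {x y} → mapO x Y.≈O mapO y → x X.≈O y
  mapO-reflects-≈O (e , e') = e , reflect₀ e'

  mapL-reflects-WF : ∀ x u → Y.WF (mapO x) (mapL u) → X.WF x u
  mapL-reflects-WF x [] _ = _
  mapL-reflects-WF x (inj₁ c ∷ u) (ok , oks) =
    ok , mapL-reflects-WF _ u (Y.WF-cong (step-map x (inj₁ c)) (Y.reflL (mapL u)) oks)
  mapL-reflects-WF x (inj₂ a ∷ u) (ok , oks) =
    reflect₀ (A.trans₀ (A.sym₀ (Φ.F-src a)) ok) ,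
    mapL-reflects-WF _ u (Y.WF-cong (step-map x (inj₂ a)) (Y.reflL (mapL u)) oks)

  mapW-reflects-R : ∀ {x u y v} → X.WF x u → X.WF y v →
                    Y.R (mapO x) (mapL u) (mapO y) (mapL v) → X.R x u y v
  mapW-reflects-R ok ok' r with RY.R⇒Joinable r
  ... | RY.join ra rb a≈b with ↝*-lift (Y.reflL _) ra | ↝*-lift (Y.reflL _) rb
  ... | _ , ru , a≈u₁ | _ , rv , b≈v₁ =
    RX.Joinable⇒R (mapO-reflects-≈O (Y.R-src r)) ok ok'
      (RX.join ru rv (mapL-reflects-≈L (RY.≈L-trans (Y.symL a≈u₁) (RY.≈L-trans a≈b b≈v₁))))

  funnyMap-reflects : CatFunReflects funnyMap
  funnyMap-reflects = record
    { reflect₀ = mapO-reflects-≈O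
    ; reflect₁ = λ {f} {g} → mapW-reflects-R (X.wf f) (X.wf g) }

module TwoFunctorProperties {M N : TwoCat} (Φ : Fun M N) where
  private
    module M = TwoCat M
    module N = TwoCat N
    module Φ = Fun Φ

  F₁-composable : ∀ {f g} → M.tgt f M.≈₀ M.src g → N.tgt (Φ.F₁ f) N.≈₀ N.src (Φ.F₁ g)
  F₁-composable p = N.trans₀ (Φ.F-tgt _) (N.trans₀ (Φ.F₀-cong p) (N.sym₀ (Φ.F-src _)))

  F₂-vcomposable : ∀ {α β} → M.cod α M.≈₁ M.dom β → N.cod (Φ.F₂ α) N.≈₁ N.dom (Φ.F₂ β)
  F₂-vcomposable p = N.trans₁ (Φ.F-cod _) (N.trans₁ (Φ.F₁-cong p) (N.sym₁ (Φ.F-dom _)))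

  F₂-hcomposable : ∀ {α β} → M.tgt (M.dom α) M.≈₀ M.src (M.dom β) →
                   N.tgt (N.dom (Φ.F₂ α)) N.≈₀ N.src (N.dom (Φ.F₂ β))
  F₂-hcomposable p =
    N.trans₀ (N.tgt-cong (Φ.F-dom _)) (N.trans₀ (F₁-composable p) (N.sym₀ (N.src-cong (Φ.F-dom _))))

module _ {P Q : TwoCat} where
  private
    module P = TwoCat P
    module Q = TwoCat Q

  record Reflects (Φ : Fun P Q) : Set where
    field
      underlying : CatFunReflects (Fun.F Φ)
      reflect₂   : ∀ {α β} → Fun.F₂ Φ α Q.≈₂ Fun.F₂ Φ β → α P.≈₂ β
    open CatFunReflects underlying public

  record PointwiseLift {X : TwoCat} (Φ : Fun P Q) (H : Fun X Q) : Set where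
    field
      lift₀    : TwoCat.Ob X → P.Ob
      lift₀-eq : ∀ x → Fun.F₀ Φ (lift₀ x) Q.≈₀ Fun.F₀ H x
      lift₁    : TwoCat.Hom X → P.Hom
      lift₁-eq : ∀ f → Fun.F₁ Φ (lift₁ f) Q.≈₁ Fun.F₁ H f
      lift₂    : TwoCat.Cell X → P.Cell
      lift₂-eq : ∀ α → Fun.F₂ Φ (lift₂ α) Q.≈₂ Fun.F₂ H α

  ∘F-cancelˡ : ∀ {X} {Φ : Fun P Q} {K K' : Fun X P} → Reflects Φ → Φ ∘F K ≐ Φ ∘F K' → K ≐ K'
  ∘F-cancelˡ r (e₀ , e₁ , e₂) =
    (λ x → reflect₀ (e₀ x)) , (λ f → reflect₁ (e₁ f)) , (λ α → reflect₂ (e₂ α))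
    where open Reflects r

  -- Each law is the corresponding law of H, transported along the lifting
  -- equations and reflected by Φ.
  factor : ∀ {X} {Φ : Fun P Q} {H : Fun X Q} → Reflects Φ → PointwiseLift Φ H → Fun X P
  factor {X} {Φ} {H} r L = record
    { F = record
        { F₀ = lift₀
        ; F₀-cong = λ {x} {y} e →
            reflect₀ (Q.trans₀ (lift₀-eq x) (Q.trans₀ (H.F₀-cong e) (Q.sym₀ (lift₀-eq y))))
        ; F₁ = lift₁
        ; F₁-cong = λ {f} {g} e →
            reflect₁ (Q.trans₁ (lift₁-eq f) (Q.trans₁ (H.F₁-cong e) (Q.sym₁ (lift₁-eq g))))
        ; F-src = λ f → reflect₀ (Q.trans₀ (Q.sym₀ (Φ.F-src _))
                          (Q.trans₀ (Q.src-cong (lift₁-eq f)) (Q.trans₀ (H.F-src f) (Q.sym₀ (lift₀-eq _)))))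
        ; F-tgt = λ f → reflect₀ (Q.trans₀ (Q.sym₀ (Φ.F-tgt _))
                          (Q.trans₀ (Q.tgt-cong (lift₁-eq f)) (Q.trans₀ (H.F-tgt f) (Q.sym₀ (lift₀-eq _)))))
        ; F-idn = λ x → reflect₁ (Q.trans₁ (lift₁-eq _) (Q.trans₁ (H.F-idn x)
                          (Q.trans₁ (Q.idn-cong (Q.sym₀ (lift₀-eq x))) (Q.sym₁ (Φ.F-idn _)))))
        ; F-cmp = λ f g p q → reflect₁ (Q.trans₁ (lift₁-eq _) (Q.trans₁ (H.F-cmp f g p (HP.F₁-composable p))
                          (Q.trans₁ (Q.cmp-cong (Q.sym₁ (lift₁-eq f)) (Q.sym₁ (lift₁-eq g)) _ (ΦP.F₁-composable q))
                                    (Q.sym₁ (Φ.F-cmp _ _ q _)))))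
        }
    ; F₂ = lift₂
    ; F₂-cong = λ {α} {β} e →
        reflect₂ (Q.trans₂ (lift₂-eq α) (Q.trans₂ (H.F₂-cong e) (Q.sym₂ (lift₂-eq β))))
    ; F-dom = λ α → reflect₁ (Q.trans₁ (Q.sym₁ (Φ.F-dom _))
                    (Q.trans₁ (Q.dom-cong (lift₂-eq α)) (Q.trans₁ (H.F-dom α) (Q.sym₁ (lift₁-eq _)))))
    ; F-cod = λ α → reflect₁ (Q.trans₁ (Q.sym₁ (Φ.F-cod _))
                    (Q.trans₁ (Q.cod-cong (lift₂-eq α)) (Q.trans₁ (H.F-cod α) (Q.sym₁ (lift₁-eq _)))))
    ; F-idc = λ f → reflect₂ (Q.trans₂ (lift₂-eq _) (Q.trans₂ (H.F-idc f)
                    (Q.trans₂ (Q.idc-cong (Q.sym₁ (lift₁-eq f))) (Q.sym₂ (Φ.F-idc _)))))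
    ; F-vcmp = λ α β p q → reflect₂ (Q.trans₂ (lift₂-eq _) (Q.trans₂ (H.F-vcmp α β p (HP.F₂-vcomposable p))
                    (Q.trans₂ (Q.vcmp-cong (Q.sym₂ (lift₂-eq α)) (Q.sym₂ (lift₂-eq β)) _ (ΦP.F₂-vcomposable q))
                              (Q.sym₂ (Φ.F-vcmp _ _ q _)))))
    ; F-hcmp = λ α β p q → reflect₂ (Q.trans₂ (lift₂-eq _) (Q.trans₂ (H.F-hcmp α β p (HP.F₂-hcomposable p))
                    (Q.trans₂ (Q.hcmp-cong (Q.sym₂ (lift₂-eq α)) (Q.sym₂ (lift₂-eq β)) _ (ΦP.F₂-hcomposable q))
                              (Q.sym₂ (Φ.F-hcmp _ _ q _)))))
    }
    where
      module Φ = Fun Φ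
      module H = Fun H
      module ΦP = TwoFunctorProperties Φ
      module HP = TwoFunctorProperties H
      open Reflects r
      open PointwiseLift L

  factor-eq : ∀ {X} {Φ : Fun P Q} {H : Fun X Q} (r : Reflects Φ) (L : PointwiseLift Φ H) →
              Φ ∘F factor r L ≐ H
  factor-eq r L = lift₀-eq , lift₁-eq , lift₂-eq
    where open PointwiseLift L

module _ {𝒜 ℬ : TwoCat} {F G : Fun 𝒜 ℬ} {S : Fun ℬ 𝒜} (SF : S ∘F F ≐ idF) (SG : S ∘F G ≐ idF) where
  private
    module 𝒜 = TwoCat 𝒜
    module ℬ = TwoCat ℬ
    module F = Fun F
    module G = Fun G
    module S = Fun S

  retractions-identify₀ : ∀ {a b} → F.F₀ a ℬ.≈₀ G.F₀ b → a 𝒜.≈₀ b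
  retractions-identify₀ e = 𝒜.trans₀ (𝒜.sym₀ (proj₁ SF _)) (𝒜.trans₀ (S.F₀-cong e) (proj₁ SG _))

  retractions-identify₁ : ∀ {f g} → F.F₁ f ℬ.≈₁ G.F₁ g → f 𝒜.≈₁ g
  retractions-identify₁ e =
    𝒜.trans₁ (𝒜.sym₁ (proj₁ (proj₂ SF) _)) (𝒜.trans₁ (S.F₁-cong e) (proj₁ (proj₂ SG) _))

  retractions-identify₂ : ∀ {α β} → F.F₂ α ℬ.≈₂ G.F₂ β → α 𝒜.≈₂ β
  retractions-identify₂ e =
    𝒜.trans₂ (𝒜.sym₂ (proj₂ (proj₂ SF) _)) (𝒜.trans₂ (S.F₂-cong e) (proj₂ (proj₂ SG) _))

retraction⇒reflects : ∀ {𝒜 ℬ} {F : Fun 𝒜 ℬ} {S : Fun ℬ 𝒜} → S ∘F F ≐ idF → Reflects F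
retraction⇒reflects {F = F} {S} SF = record
  { underlying = record
      { reflect₀ = retractions-identify₀ {F = F} {F} {S} SF SF
      ; reflect₁ = retractions-identify₁ {F = F} {F} {S} SF SF }
  ; reflect₂ = retractions-identify₂ {F = F} {F} {S} SF SF }

prodMap-reflects : ∀ (𝒞 : TwoCat) {𝒜 ℬ} {F : Fun 𝒜 ℬ} → Reflects F → Reflects (prodMap 𝒞 F)
prodMap-reflects 𝒞 r = record
  { underlying = record
      { reflect₀ = λ { (e , e') → e , reflect₀ e' }
      ; reflect₁ = λ { (e , e') → e , reflect₁ e' } }
  ; reflect₂ = λ { (e , e') → e , reflect₂ e' } }
  where open Reflects r

module FullMapProperties (U U' : Cat) (P P' : TwoCat)
  (Φ : CatFun U (TwoCat.cat P)) (Φ' : CatFun U' (TwoCat.cat P'))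
  (H : CatFun U U') (K : Fun P P')
  (comm : ∀ f → TwoCat._≈₁_ P' (CatFun.F₁ Φ' (CatFun.F₁ H f)) (Fun.F₁ K (CatFun.F₁ Φ f)))
  (H-reflects : CatFunReflects H) (K-reflects : Reflects K) where
  open FullMap U U' P P' Φ Φ' H K comm
  private
    module U' = Cat U'
    module P = TwoCat P
    module P' = TwoCat P'
    module Φ' = CatFun Φ'
    module H = CatFun H
    module K = Fun K
    module X = Full U P Φ
    module Y = Full U' P' Φ'
    open Y.FCell
    module HR = CatFunReflects H-reflects
    module KR = Reflects K-reflects

  mapFun-reflects : Reflects mapFun
  mapFun-reflects = record
    { underlying = H-reflects
    ; reflect₂ = λ { (ed , ec , eα) → HR.reflect₁ ed , HR.reflect₁ ec , KR.reflect₂ eα } }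

  lift-cell : (β : Y.FCell) (d' c' : Cat.Hom U) (α' : P.Cell) →
              H.F₁ d' U'.≈₁ d β → H.F₁ c' U'.≈₁ c β → K.F₂ α' P'.≈₂ α β →
              Σ X.FCell λ β' → map₂ β' Y.≈F β
  lift-cell β d' c' α' ed ec eα = X.fc d' c' α' pd' pc' ps' pt' , ed , ec , eα
    where
      pd' = KR.reflect₁ (P'.trans₁ (P'.sym₁ (K.F-dom α')) (P'.trans₁ (P'.dom-cong eα)
              (P'.trans₁ (pd β) (P'.trans₁ (Φ'.F₁-cong (U'.sym₁ ed)) (comm d')))))
      pc' = KR.reflect₁ (P'.trans₁ (P'.sym₁ (K.F-cod α')) (P'.trans₁ (P'.cod-cong eα)
              (P'.trans₁ (pc β) (P'.trans₁ (Φ'.F₁-cong (U'.sym₁ ec)) (comm c')))))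
      ps' = HR.reflect₀ (U'.trans₀ (U'.sym₀ (H.F-src d')) (U'.trans₀ (U'.src-cong ed)
              (U'.trans₀ (ps β) (U'.trans₀ (U'.sym₀ (U'.src-cong ec)) (H.F-src c')))))
      pt' = HR.reflect₀ (U'.trans₀ (U'.sym₀ (H.F-tgt d')) (U'.trans₀ (U'.tgt-cong ed)
              (U'.trans₀ (pt β) (U'.trans₀ (U'.sym₀ (U'.tgt-cong ec)) (H.F-tgt c')))))

module GrayMap (𝒞 : TwoCat) {𝒜' 𝒜 : TwoCat} (E : Fun 𝒜' 𝒜) (E-reflects : Reflects E) where
  private
    module C = TwoCat 𝒞
    module A' = TwoCat 𝒜'
    module A = TwoCat 𝒜
    module M = FunnyMap C.cat A'.cat A.cat (Fun.F E)
    module WL = WordLifting C.cat A'.cat A.cat (Fun.F E) (Reflects.underlying E-reflects)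
  open FullMapProperties (Funny.FunnyCat C.cat A'.cat) (Funny.FunnyCat C.cat A.cat)
    (𝒞 ×₂ 𝒜') (𝒞 ×₂ 𝒜) (Funny.Π C.cat A'.cat) (Funny.Π C.cat A.cat) M.funnyMap (prodMap 𝒞 E)
    (λ f → M.πm₁ (Funny.st f) (Funny.gs f) (Funny.wf f) _ , M.πm₂ (Funny.st f) (Funny.gs f) (Funny.wf f) _)
    WL.funnyMap-reflects (prodMap-reflects 𝒞 E-reflects)
    public

  ⊠F-reflects : Reflects (𝒞 ⊠F E)
  ⊠F-reflects = mapFun-reflects

⊠F-preserves-forks : ∀ (𝒞 : TwoCat) {𝒜 ℬ ℰ} {F G : Fun 𝒜 ℬ} {E : Fun ℰ 𝒜} →
                     F ∘F E ≐ G ∘F E → (𝒞 ⊠F F) ∘F (𝒞 ⊠F E) ≐ (𝒞 ⊠F G) ∘F (𝒞 ⊠F E)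
⊠F-preserves-forks 𝒞 {𝒜} {ℬ} {ℰ} {F} {G} {E} (fork₀ , fork₁ , fork₂) =
  (λ x → C.refl₀ , fork₀ (proj₂ x)) ,
  (λ f → fork-word (XE.st f) (XE.gs f)) ,
  (λ β → fork-word _ (XE.gs (PE.FCell.d β)) , fork-word _ (XE.gs (PE.FCell.c β)) ,
         C.refl₂ , fork₂ (proj₂ (PE.FCell.α β)))
  where
    module C = TwoCat 𝒞
    Cc = TwoCat.cat 𝒞
    Ac = TwoCat.cat 𝒜
    Bc = TwoCat.cat ℬ
    Ec = TwoCat.cat ℰ
    module XE = Funny Cc Ec
    module YB = Funny Cc Bc
    module MF = FunnyMap Cc Ac Bc (Fun.F F)
    module MG = FunnyMap Cc Ac Bc (Fun.F G)
    module ME = FunnyMap Cc Ec Ac (Fun.F E)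
    module PE = Full (Funny.FunnyCat Cc Ec) (𝒞 ×₂ ℰ) (Funny.Π Cc Ec)

    fork-letters : ∀ u → MF.mapL (ME.mapL u) YB.≈L MG.mapL (ME.mapL u)
    fork-letters [] = YB.[]
    fork-letters (inj₁ _ ∷ u) = YB.g₁ C.refl₁ YB.∷ fork-letters u
    fork-letters (inj₂ e ∷ u) = YB.g₂ (fork₁ e) YB.∷ fork-letters u

    fork-word : ∀ x u → YB.R (MF.mapO (ME.mapO x)) (MF.mapL (ME.mapL u))
                             (MG.mapO (ME.mapO x)) (MG.mapL (ME.mapL u))
    fork-word x u = YB.~cong (C.refl₀ , fork₀ (proj₂ x)) (fork-letters u)

module EqualizerLifts {𝒜 ℬ ℰ : TwoCat} (F G : Fun 𝒜 ℬ) (E : Fun ℰ 𝒜) (eq : IsEqualizer F G E) where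
  private
    module A = TwoCat 𝒜
    module B = TwoCat ℬ
    module Ee = TwoCat ℰ
    module F = Fun F
    module G = Fun G
    module E = Fun E
    module FP = TwoFunctorProperties F
    module GP = TwoFunctorProperties G

  -- The equalizer computed pointwise; its comparison 2-functor into ℰ lifts the
  -- cells on which F and G agree.
  AgreeCat : Cat
  AgreeCat = record
    { Ob = Σ A.Ob λ a → F.F₀ a B.≈₀ G.F₀ a
    ; _≈₀_ = λ x y → proj₁ x A.≈₀ proj₁ y
    ; isEq₀ = record { refl = A.refl₀ ; sym = A.sym₀ ; trans = A.trans₀ }
    ; Hom = Σ A.Hom λ f → F.F₁ f B.≈₁ G.F₁ f
    ; _≈₁_ = λ f g → proj₁ f A.≈₁ proj₁ g
    ; isEq₁ = record { refl = A.refl₁ ; sym = A.sym₁ ; trans = A.trans₁ }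
    ; src = λ { (f , p) → A.src f , B.trans₀ (B.sym₀ (F.F-src f)) (B.trans₀ (B.src-cong p) (G.F-src f)) }
    ; tgt = λ { (f , p) → A.tgt f , B.trans₀ (B.sym₀ (F.F-tgt f)) (B.trans₀ (B.tgt-cong p) (G.F-tgt f)) }
    ; src-cong = A.src-cong
    ; tgt-cong = A.tgt-cong
    ; idn = λ { (a , p) → A.idn a , B.trans₁ (F.F-idn a) (B.trans₁ (B.idn-cong p) (B.sym₁ (G.F-idn a))) }
    ; idn-cong = A.idn-cong
    ; src-idn = λ _ → A.src-idn _
    ; tgt-idn = λ _ → A.tgt-idn _
    ; cmp = λ { (f , p) (g , q) r → A.cmp f g r ,
        B.trans₁ (F.F-cmp f g r (FP.F₁-composable r))
                 (B.trans₁ (B.cmp-cong p q _ (GP.F₁-composable r)) (B.sym₁ (G.F-cmp f g r _))) }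
    ; cmp-cong = A.cmp-cong
    ; src-cmp = λ _ _ _ → A.src-cmp _ _ _
    ; tgt-cmp = λ _ _ _ → A.tgt-cmp _ _ _
    ; idˡ = λ _ _ → A.idˡ _ _
    ; idʳ = λ _ _ → A.idʳ _ _
    ; assoc = λ _ _ _ _ _ _ _ → A.assoc _ _ _ _ _ _ _
    }

  Agree : TwoCat
  Agree = record
    { cat = AgreeCat
    ; Cell = Σ A.Cell λ α → F.F₂ α B.≈₂ G.F₂ α
    ; _≈₂_ = λ α β → proj₁ α A.≈₂ proj₁ β
    ; isEq₂ = record { refl = A.refl₂ ; sym = A.sym₂ ; trans = A.trans₂ }
    ; dom = λ { (α , p) → A.dom α , B.trans₁ (B.sym₁ (F.F-dom α)) (B.trans₁ (B.dom-cong p) (G.F-dom α)) }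
    ; cod = λ { (α , p) → A.cod α , B.trans₁ (B.sym₁ (F.F-cod α)) (B.trans₁ (B.cod-cong p) (G.F-cod α)) }
    ; dom-cong = A.dom-cong
    ; cod-cong = A.cod-cong
    ; glob-src = λ _ → A.glob-src _
    ; glob-tgt = λ _ → A.glob-tgt _
    ; idc = λ { (f , p) → A.idc f , B.trans₂ (F.F-idc f) (B.trans₂ (B.idc-cong p) (B.sym₂ (G.F-idc f))) }
    ; idc-cong = A.idc-cong
    ; dom-idc = λ _ → A.dom-idc _
    ; cod-idc = λ _ → A.cod-idc _
    ; vcmp = λ { (α , p) (β , q) r → A.vcmp α β r ,
        B.trans₂ (F.F-vcmp α β r (FP.F₂-vcomposable r))
                 (B.trans₂ (B.vcmp-cong p q _ (GP.F₂-vcomposable r)) (B.sym₂ (G.F-vcmp α β r _))) }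
    ; vcmp-cong = A.vcmp-cong
    ; dom-vcmp = λ _ _ _ → A.dom-vcmp _ _ _
    ; cod-vcmp = λ _ _ _ → A.cod-vcmp _ _ _
    ; vidˡ = λ _ _ → A.vidˡ _ _
    ; vidʳ = λ _ _ → A.vidʳ _ _
    ; vassoc = λ _ _ _ _ _ _ _ → A.vassoc _ _ _ _ _ _ _
    ; hcmp = λ { (α , p) (β , q) r → A.hcmp α β r ,
        B.trans₂ (F.F-hcmp α β r (FP.F₂-hcomposable r))
                 (B.trans₂ (B.hcmp-cong p q _ (GP.F₂-hcomposable r)) (B.sym₂ (G.F-hcmp α β r _))) }
    ; hcmp-cong = A.hcmp-cong
    ; dom-hcmp = λ _ _ _ _ → A.dom-hcmp _ _ _ _
    ; cod-hcmp = λ _ _ _ _ → A.cod-hcmp _ _ _ _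
    ; hidˡ = λ _ _ → A.hidˡ _ _
    ; hidʳ = λ _ _ → A.hidʳ _ _
    ; hassoc = λ _ _ _ _ _ _ _ → A.hassoc _ _ _ _ _ _ _
    ; hcmp-idc = λ _ _ _ _ → A.hcmp-idc _ _ _ _
    ; interchange = λ _ _ _ _ _ _ _ _ _ _ → A.interchange _ _ _ _ _ _ _ _ _ _
    }

  inclusion : Fun Agree 𝒜
  inclusion = record
    { F = record
        { F₀ = proj₁ ; F₀-cong = λ e → e ; F₁ = proj₁ ; F₁-cong = λ e → e
        ; F-src = λ _ → A.refl₀ ; F-tgt = λ _ → A.refl₀ ; F-idn = λ _ → A.refl₁
        ; F-cmp = λ _ _ p q → A.cmp-cong A.refl₁ A.refl₁ p q }
    ; F₂ = proj₁ ; F₂-cong = λ e → e ; F-dom = λ _ → A.refl₁ ; F-cod = λ _ → A.refl₁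
    ; F-idc = λ _ → A.refl₂
    ; F-vcmp = λ _ _ p q → A.vcmp-cong A.refl₂ A.refl₂ p q
    ; F-hcmp = λ _ _ p q → A.hcmp-cong A.refl₂ A.refl₂ p q }

  corestriction : Fun ℰ Agree
  corestriction = record
    { F = record
        { F₀ = λ x → E.F₀ x , proj₁ (proj₁ eq) x
        ; F₀-cong = E.F₀-cong
        ; F₁ = λ f → E.F₁ f , proj₁ (proj₂ (proj₁ eq)) f
        ; F₁-cong = E.F₁-cong
        ; F-src = E.F-src ; F-tgt = E.F-tgt ; F-idn = E.F-idn
        ; F-cmp = E.F-cmp }
    ; F₂ = λ α → E.F₂ α , proj₂ (proj₂ (proj₁ eq)) α
    ; F₂-cong = E.F₂-cong
    ; F-dom = E.F-dom ; F-cod = E.F-cod ; F-idc = E.F-idc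
    ; F-vcmp = E.F-vcmp ; F-hcmp = E.F-hcmp }

  private
    comparison-exists : Σ (Fun Agree ℰ) λ K → E ∘F K ≐ inclusion
    comparison-exists = proj₁ (proj₂ eq) Agree inclusion (proj₂ , proj₂ , proj₂)

  comparison : Fun Agree ℰ
  comparison = proj₁ comparison-exists

  comparison-eq : E ∘F comparison ≐ inclusion
  comparison-eq = proj₂ comparison-exists

  comparison-retracts : comparison ∘F corestriction ≐ idF
  comparison-retracts = proj₂ (proj₂ eq) ℰ (comparison ∘F corestriction) idF
    ( (λ x → proj₁ comparison-eq (Fun.F₀ corestriction x))
    , (λ f → proj₁ (proj₂ comparison-eq) (Fun.F₁ corestriction f))
    , (λ α → proj₂ (proj₂ comparison-eq) (Fun.F₂ corestriction α)))

  lift₀ : (a : A.Ob) → F.F₀ a B.≈₀ G.F₀ a → Ee.Ob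
  lift₀ a p = Fun.F₀ comparison (a , p)

  lift₀-eq : ∀ a p → E.F₀ (lift₀ a p) A.≈₀ a
  lift₀-eq a p = proj₁ comparison-eq (a , p)

  lift₁ : (f : A.Hom) → F.F₁ f B.≈₁ G.F₁ f → Ee.Hom
  lift₁ f p = Fun.F₁ comparison (f , p)

  lift₁-eq : ∀ f p → E.F₁ (lift₁ f p) A.≈₁ f
  lift₁-eq f p = proj₁ (proj₂ comparison-eq) (f , p)

  lift₂ : (α : A.Cell) → F.F₂ α B.≈₂ G.F₂ α → Ee.Cell
  lift₂ α p = Fun.F₂ comparison (α , p)

  lift₂-eq : ∀ α p → E.F₂ (lift₂ α p) A.≈₂ α
  lift₂-eq α p = proj₂ (proj₂ comparison-eq) (α , p)

  E-reflects : Reflects E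
  E-reflects = record
    { underlying = record
        { reflect₀ = λ e → Ee.trans₀ (Ee.sym₀ (proj₁ comparison-retracts _))
                             (Ee.trans₀ (Fun.F₀-cong comparison e) (proj₁ comparison-retracts _))
        ; reflect₁ = λ e → Ee.trans₁ (Ee.sym₁ (proj₁ (proj₂ comparison-retracts) _))
                             (Ee.trans₁ (Fun.F₁-cong comparison e) (proj₁ (proj₂ comparison-retracts) _)) }
    ; reflect₂ = λ e → Ee.trans₂ (Ee.sym₂ (proj₂ (proj₂ comparison-retracts) _))
                         (Ee.trans₂ (Fun.F₂-cong comparison e) (proj₂ (proj₂ comparison-retracts) _)) }

module GrayEqualizer {𝒜 ℬ ℰ : TwoCat} (F G : Fun 𝒜 ℬ) (S : Fun ℬ 𝒜)
  (SF : S ∘F F ≐ idF) (SG : S ∘F G ≐ idF) (E : Fun ℰ 𝒜) (eq : IsEqualizer F G E) (𝒞 : TwoCat) where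
  private
    module B = TwoCat ℬ
    module C = TwoCat 𝒞
    module F = Fun F
    module G = Fun G
    Cc = TwoCat.cat 𝒞
    Ac = TwoCat.cat 𝒜
    Bc = TwoCat.cat ℬ
    Ec = TwoCat.cat ℰ
    module EL = EqualizerLifts F G E eq
    module GE = GrayMap 𝒞 E EL.E-reflects
    module YA = Funny Cc Ac
    module YB = Funny Cc Bc
    module XE = Funny Cc Ec
    module MF = FunnyMap Cc Ac Bc F.F
    module MG = FunnyMap Cc Ac Bc G.F
    module ME = FunnyMap Cc Ec Ac (Fun.F E)
    module RA = WordRewriting Cc Ac
    module RB = WordRewriting Cc Bc
    module LF = WordLifting Cc Ac Bc F.F (Reflects.underlying (retraction⇒reflects {F = F} {S} SF))
    module LG = WordLifting Cc Ac Bc G.F (Reflects.underlying (retraction⇒reflects {F = G} {S} SG))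
    module LE = WordLifting Cc Ec Ac (Fun.F E) (Reflects.underlying EL.E-reflects)
    module QA = Full (Funny.FunnyCat Cc Ac) (𝒞 ×₂ 𝒜) (Funny.Π Cc Ac)

  ⊠E-reflects : Reflects (𝒞 ⊠F E)
  ⊠E-reflects = GE.⊠F-reflects

  images-identify : ∀ {u u'} → MF.mapL u YB.≈L MG.mapL u' → u YA.≈L u'
  images-identify {[]} {[]} YB.[] = YA.[]
  images-identify {inj₁ _ ∷ _} {inj₁ _ ∷ _} (YB.g₁ e YB.∷ l) = YA.g₁ e YA.∷ images-identify l
  images-identify {inj₂ _ ∷ _} {inj₂ _ ∷ _} (YB.g₂ e YB.∷ l) =
    YA.g₂ (retractions-identify₁ {F = F} {G} {S} SF SG e) YA.∷ images-identify l
  images-identify {inj₁ _ ∷ _} {inj₂ _ ∷ _} (() YB.∷ _)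
  images-identify {inj₂ _ ∷ _} {inj₁ _ ∷ _} (() YB.∷ _)

  -- Lift both reductions back to 𝒞 ⊠ 𝒜: the two reducts of u have ≈-equal images
  -- under F and G respectively, hence coincide, because S retracts both F and G.
  agreeing-reduct : ∀ {u} → RB.Joinable (MF.mapL u) (MG.mapL u) →
                    ∃[ u₁ ] (u RA.↝* u₁ × MF.mapL u₁ YB.≈L MG.mapL u₁)
  agreeing-reduct (RB.join Fu↝a Gu↝b a≈b)
    with LF.↝*-lift (YB.reflL _) Fu↝a | LG.↝*-lift (YB.reflL _) Gu↝b
  ... | u₁ , u↝u₁ , a≈Fu₁ | _ , _ , b≈Gu₂ =
    u₁ , u↝u₁ , RB.≈L-trans Fu₁≈Gu₂ (MG.L-map (YA.symL (images-identify Fu₁≈Gu₂)))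
    where
      Fu₁≈Gu₂ = RB.≈L-trans (YB.symL a≈Fu₁) (RB.≈L-trans a≈b b≈Gu₂)

  liftLetters : ∀ u → MF.mapL u YB.≈L MG.mapL u → List XE.Gen
  liftLetters [] _ = []
  liftLetters (inj₁ c ∷ u) (_ YB.∷ l) = inj₁ c ∷ liftLetters u l
  liftLetters (inj₂ a ∷ u) (YB.g₂ e YB.∷ l) = inj₂ (EL.lift₁ a e) ∷ liftLetters u l

  liftLetters-eq : ∀ u l → ME.mapL (liftLetters u l) YA.≈L u
  liftLetters-eq [] YB.[] = YA.[]
  liftLetters-eq (inj₁ _ ∷ u) (YB.g₁ _ YB.∷ l) = YA.g₁ C.refl₁ YA.∷ liftLetters-eq u l
  liftLetters-eq (inj₂ a ∷ u) (YB.g₂ e YB.∷ l) = YA.g₂ (EL.lift₁-eq a e) YA.∷ liftLetters-eq u l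

  liftObject : (x : YA.Ob) → F.F₀ (proj₂ x) B.≈₀ G.F₀ (proj₂ x) → XE.Ob
  liftObject x e = proj₁ x , EL.lift₀ (proj₂ x) e

  liftObject-eq : ∀ x e → ME.mapO (liftObject x e) YA.≈O x
  liftObject-eq x e = C.refl₀ , EL.lift₀-eq (proj₂ x) e

  liftWord : (f : YA.W) → YB.R (MF.mapO (YA.st f)) (MF.mapL (YA.gs f)) (MG.mapO (YA.st f)) (MG.mapL (YA.gs f)) →
             Σ XE.W λ f' → YA.R (ME.mapO (XE.st f')) (ME.mapL (XE.gs f')) (YA.st f) (YA.gs f)
  liftWord (YA.w x u ok) r with agreeing-reduct (RB.R⇒Joinable r)
  ... | u₁ , u↝u₁ , agree =
    XE.w x' (liftLetters u₁ agree) wf ,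
    YA.~trans (YA.~cong x'-eq (liftLetters-eq u₁ agree)) (YA.~sym (RA.↝*⇒R ok u↝u₁))
    where
      x' = liftObject x (proj₂ (YB.R-src r))
      x'-eq = liftObject-eq x (proj₂ (YB.R-src r))
      wf = LE.mapL-reflects-WF x' _
             (YA.WF-cong (YA.symO x'-eq) (YA.symL (liftLetters-eq u₁ agree)) (RA.↝*-preserves-WF ok u↝u₁))

  liftCell : (β : QA.FCell) → TwoCat._≈₂_ (𝒞 ⊠ ℬ) (Fun.F₂ (𝒞 ⊠F F) β) (Fun.F₂ (𝒞 ⊠F G) β) →
             Σ (TwoCat.Cell (𝒞 ⊠ ℰ)) λ β' → TwoCat._≈₂_ (𝒞 ⊠ 𝒜) (Fun.F₂ (𝒞 ⊠F E) β') β
  liftCell β (d-agree , c-agree , _ , α-agree) =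
    GE.lift-cell β (proj₁ d') (proj₁ c') (proj₁ (QA.FCell.α β) , EL.lift₂ _ α-agree)
      (proj₂ d') (proj₂ c') (C.refl₂ , EL.lift₂-eq _ α-agree)
    where
      d' = liftWord (QA.FCell.d β) d-agree
      c' = liftWord (QA.FCell.c β) c-agree

  pointwiseLift : ∀ {X} (H : Fun X (𝒞 ⊠ 𝒜)) → (𝒞 ⊠F F) ∘F H ≐ (𝒞 ⊠F G) ∘F H →
                  PointwiseLift (𝒞 ⊠F E) H
  pointwiseLift H (agree₀ , agree₁ , agree₂) = record
    { lift₀ = λ x → liftObject (H.F₀ x) (proj₂ (agree₀ x))
    ; lift₀-eq = λ x → liftObject-eq (H.F₀ x) (proj₂ (agree₀ x))
    ; lift₁ = λ f → proj₁ (liftWord (H.F₁ f) (agree₁ f))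
    ; lift₁-eq = λ f → proj₂ (liftWord (H.F₁ f) (agree₁ f))
    ; lift₂ = λ α → proj₁ (liftCell (H.F₂ α) (agree₂ α))
    ; lift₂-eq = λ α → proj₂ (liftCell (H.F₂ α) (agree₂ α)) }
    where module H = Fun H

mainTheorem6 : ∀ {𝒜 ℬ ℰ : TwoCat} (F G : Fun 𝒜 ℬ) (S : Fun ℬ 𝒜) →
                 S ∘F F ≐ idF → S ∘F G ≐ idF →
                 (E : Fun ℰ 𝒜) → IsEqualizer F G E →
                 (𝒞 : TwoCat) → IsEqualizer (𝒞 ⊠F F) (𝒞 ⊠F G) (𝒞 ⊠F E)
mainTheorem6 F G S SF SG E eq 𝒞 =
  ⊠F-preserves-forks 𝒞 {F = F} {G} {E} (proj₁ eq) ,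
  (λ X H agree → factor ⊠E-reflects (pointwiseLift H agree) , factor-eq ⊠E-reflects (pointwiseLift H agree)) ,
  (λ X K K' → ∘F-cancelˡ {K = K} {K'} ⊠E-reflects)
  where open GrayEqualizer F G S SF SG E eq 𝒞
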